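{- Let ${\boldsymbol q}$ be a CQ and $\mathcal{T}$ an ontology. (i) For any FO-rewriting (respectively PE-rewriting) ${\boldsymbol q}'$ of ${\boldsymbol q}$ and $\mathcal{T}$ over complete data, there is an FO-rewriting (respectively PE-rewriting) ${\boldsymbol q}''$ of ${\boldsymbol q}$ and $\mathcal{T}$ over arbitrary data with $|{\boldsymbol q}''|\le O(|{\boldsymbol q}'|\cdot|\mathcal{T}|)$. (ii) For any NDL-rewriting $(\Pi,{\boldsymbol q}')$ of ${\boldsymbol q}$ and $\mathcal{T}$ over complete data, there is an NDL-rewriting $(\Pi',{\boldsymbol q}')$ over arbitrary data with $|\Pi'|\le|\Pi|+O(|\mathcal{T}|)$.
   Context: An ontology $\mathcal{T}$ is a finite set of tgds $\forall \vec{x}\,(\varphi(\vec{x}) \to \exists \vec{y} \bigwedge_i \psi_i(\vec{x},\vec{y}))$ with $\varphi,\psi_i$ unary or binary atoms without constants and $|\vec{x}\cup\vec{y}|\le 2$; $|\mathcal{T}|$ is the number of predicate occurrences. A data instance $\mathcal{A}$ is a finite set of ground atoms with constants $\mathsf{ind}(\mathcal{A})$; it is complete if for every ground atom $S(\vec{a})$, $\vec a\subseteq\mathsf{ind}(\mathcal{A})$, $\mathcal{T},\mathcal{A}\models S(\vec{a})$ implies $S(\vec{a})\in\mathcal{A}$. A CQ ${\boldsymbol q}(\vec{x})=\exists\vec{y}\,\varphi(\vec{x},\vec{y})$ has $\varphi$ a conjunction of unary/binary atoms over variables. An FO-rewriting over complete data is a first-order formula ${\boldsymbol q}'(\vec{x})$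 without constants with $\mathcal{T},\mathcal{A}\models{\boldsymbol q}(\vec{a})$ iff $\mathcal{A}\models{\boldsymbol q}'(\vec{a})$ for every complete $\mathcal{A}$ and $\vec{a}\subseteq\mathsf{ind}(\mathcal{A})$; a PE-rewriting is such a formula that is positive existential. An NDL-rewriting over complete data is a pair $(\Pi,{\boldsymbol q}')$ of a nonrecursive datalog program and an atom ${\boldsymbol q}'(\vec x)$ with $\mathcal{T},\mathcal{A}\models{\boldsymbol q}(\vec{a})$ iff $\Pi,\mathcal{A}\models{\boldsymbol q}'(\vec{a})$ for all complete $\mathcal{A}$ and $\vec{a}$. Rewritings over arbitrary data are defined in the same way but quantifying over all data instances $\mathcal{A}$, not only complete ones. $|{\boldsymbol q}'|$ is the length of a formula and $|\Pi|$ the size of a program. -}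

module Defs where

open import Data.Nat using (ℕ; zero; suc; _+_; _*_; _≤_; _<_)
open import Data.Fin using (Fin; zero; suc)
open import Data.Bool using (Bool; true; false)
open import Data.List using (List; []; _∷_; concatMap; length; map)
open import Data.Nat.ListAction using (sum)
open import Data.List.Membership.Propositional using (_∈_)
open import Data.List.Relation.Unary.All using (All)
open import Data.Product using (Σ; _×_; _,_)
open import Data.Sum using (_⊎_; inj₁; inj₂; [_,_])
open import Data.Unit using (⊤)
open import Data.Empty using (⊥)
open import Relation.Binary.PropositionalEquality using (_≡_)
open import Relation.Nullary using (¬_)
import Data.Vec.Functional as VF

data Atom (V : Set) : Set where
  un  : ℕ → V → Atom V
  bin : ℕ → V → V → Atom V

mapAtom : {V W : Set} → (V → W) → Atom V → Atom W
mapAtom f (un p v)    = un p (f v)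
mapAtom f (bin p v w) = bin p (f v) (f w)

termsOf : {V : Set} → Atom V → List V
termsOf (un p v)    = v ∷ []
termsOf (bin p v w) = v ∷ w ∷ []

record Interp : Set₁ where
  field
    Dom : Set
    UI  : ℕ → Dom → Set
    BI  : ℕ → Dom → Dom → Set
open Interp public

HoldsA : (I : Interp) {V : Set} → (V → Dom I) → Atom V → Set
HoldsA I ρ (un p v)    = UI I p (ρ v)
HoldsA I ρ (bin p v w) = BI I p (ρ v) (ρ w)

-- Ontologies: tgds  ∀x (φ(x) → ∃y ⋀ ψ_i(x,y))  with at most two
-- variables (named by Fin 2), a single body atom, head a list of atoms.
-- The universally quantified variables x are those of the body atom;
-- head variables not occurring in the body are existential (y).

record TGD : Set where
  field
    body : Atom (Fin 2)
    head : List (Atom (Fin 2))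
open TGD public

Ontology : Set
Ontology = List TGD

-- |T| = number of predicate occurrences
ontSize : Ontology → ℕ
ontSize T = sum (map (λ τ → suc (length (head τ))) T)

SatTGD : (I : Interp) → TGD → Set
SatTGD I τ = (σ : Fin 2 → Dom I) → HoldsA I σ (body τ) →
  Σ (Fin 2 → Dom I) λ σ' →
    ((v : Fin 2) → v ∈ termsOf (body τ) → σ' v ≡ σ v) × All (HoldsA I σ') (head τ)

ModelT : Interp → Ontology → Set
ModelT I T = All (SatTGD I) T

Data : Set
Data = List (Atom ℕ)

ind : Data → List ℕ
ind A = concatMap termsOf A

ModelA : (I : Interp) → (ℕ → Dom I) → Data → Set
ModelA I ι A = All (HoldsA I ι) A

Entails : Ontology → Data → Atom ℕ → Set₁
Entails T A α = (I : Interp) (ι : ℕ → Dom I) → ModelT I T → ModelA I ι A → HoldsA I ι α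

Complete : Ontology → Data → Set₁
Complete T A = (α : Atom ℕ) → All (_∈ ind A) (termsOf α) → Entails T A α → α ∈ A

-- Conjunctive queries q(x) = ∃y φ(x,y) with n answer variables
-- (inj₁ i) and ex existential variables (inj₂ j).

record CQ (n : ℕ) : Set where
  field
    nex   : ℕ
    atoms : List (Atom (Fin n ⊎ Fin nex))
open CQ public

Tuple : ℕ → Set
Tuple n = Fin n → ℕ

_⊆ind_ : {n : ℕ} → Tuple n → Data → Set
a ⊆ind A = ∀ i → a i ∈ ind A

EntailsQ : {n : ℕ} → Ontology → Data → CQ n → Tuple n → Set₁
EntailsQ T A q a = (I : Interp) (ι : ℕ → Dom I) → ModelT I T → ModelA I ι A →
  Σ (Fin (nex q) → Dom I) λ τ → All (HoldsA I [ (λ i → ι (a i)) , τ ]) (atoms q)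

-- First-order formulas without constants (with equality), n free
-- variables in de Bruijn style; evaluated on a data instance A viewed as
-- the finite structure with domain ind(A).

data Fm : ℕ → Set where
  atom  : {n : ℕ} → Atom (Fin n) → Fm n
  eq    : {n : ℕ} → Fin n → Fin n → Fm n
  tt ff : {n : ℕ} → Fm n
  neg   : {n : ℕ} → Fm n → Fm n
  and or : {n : ℕ} → Fm n → Fm n → Fm n
  ex all : {n : ℕ} → Fm (suc n) → Fm n

data IsPE : {n : ℕ} → Fm n → Set where
  atom : {n : ℕ} (α : Atom (Fin n)) → IsPE (atom α)
  eq   : {n : ℕ} (i j : Fin n) → IsPE (eq i j)
  tt   : {n : ℕ} → IsPE (tt {n})
  ff   : {n : ℕ} → IsPE (ff {n})
  and  : {n : ℕ} {φ ψ : Fm n} → IsPE φ → IsPE ψ → IsPE (and φ ψ)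
  or   : {n : ℕ} {φ ψ : Fm n} → IsPE φ → IsPE ψ → IsPE (or φ ψ)
  ex   : {n : ℕ} {φ : Fm (suc n)} → IsPE φ → IsPE (ex φ)

atomSize : {V : Set} → Atom V → ℕ
atomSize α = suc (length (termsOf α))

fmSize : {n : ℕ} → Fm n → ℕ
fmSize (atom α)  = atomSize α
fmSize (eq i j)  = 3
fmSize tt        = 1
fmSize ff        = 1
fmSize (neg φ)   = suc (fmSize φ)
fmSize (and φ ψ) = suc (fmSize φ + fmSize ψ)
fmSize (or φ ψ)  = suc (fmSize φ + fmSize ψ)
fmSize (ex φ)    = 2 + fmSize φ
fmSize (all φ)   = 2 + fmSize φ

Sat : (A : Data) {n : ℕ} → Tuple n → Fm n → Set
Sat A ρ (atom α)  = mapAtom ρ α ∈ A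
Sat A ρ (eq i j)  = ρ i ≡ ρ j
Sat A ρ tt        = ⊤
Sat A ρ ff        = ⊥
Sat A ρ (neg φ)   = ¬ Sat A ρ φ
Sat A ρ (and φ ψ) = Sat A ρ φ × Sat A ρ ψ
Sat A ρ (or φ ψ)  = Sat A ρ φ ⊎ Sat A ρ ψ
Sat A ρ (ex φ)    = Σ ℕ λ c → c ∈ ind A × Sat A (c VF.∷ ρ) φ
Sat A ρ (all φ)   = (c : ℕ) → c ∈ ind A → Sat A (c VF.∷ ρ) φ

FORewComplete : {n : ℕ} → CQ n → Ontology → Fm n → Set₁
FORewComplete q T φ = (A : Data) → Complete T A → (a : Tuple _) → a ⊆ind A →
  (EntailsQ T A q a → Sat A a φ) × (Sat A a φ → EntailsQ T A q a)

FORewArbitrary : {n : ℕ} → CQ n → Ontology → Fm n → Set₁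
FORewArbitrary q T φ = (A : Data) → (a : Tuple _) → a ⊆ind A →
  (EntailsQ T A q a → Sat A a φ) × (Sat A a φ → EntailsQ T A q a)

-- Nonrecursive datalog. IDB predicates are named by ℕ (a namespace
-- separate from the data predicates) and take lists of arguments.
-- Rule variables are Fin k.

data BodyAtom (k : ℕ) : Set where
  edb  : Atom (Fin k) → BodyAtom k
  idb  : ℕ → List (Fin k) → BodyAtom k
  eqb  : Fin k → Fin k → BodyAtom k

record Rule : Set where
  field
    nvars    : ℕ
    headPred : ℕ
    headArgs : List (Fin nvars)
    bodyAtoms : List (BodyAtom nvars)
open Rule public

Program : Set
Program = List Rule

bodyAtomSize : {k : ℕ} → BodyAtom k → ℕ
bodyAtomSize (edb α)    = atomSize α
bodyAtomSize (idb p xs) = suc (length xs)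
bodyAtomSize (eqb i j)  = 3

ruleSize : Rule → ℕ
ruleSize r = suc (length (headArgs r)) + sum (map bodyAtomSize (bodyAtoms r))

progSize : Program → ℕ
progSize Π = sum (map ruleSize Π)

Nonrecursive : Program → Set
Nonrecursive Π = Σ (ℕ → ℕ) λ rank → (r : Rule) → r ∈ Π →
  (p : ℕ) (xs : List (Fin (nvars r))) → idb p xs ∈ bodyAtoms r → rank p < rank (headPred r)

mutual
  data Derives (Π : Program) (A : Data) : ℕ → List ℕ → Set where
    apply : (r : Rule) → r ∈ Π → (σ : Fin (nvars r) → ℕ) →
            ((i : Fin (nvars r)) → σ i ∈ ind A) →
            All (BodySat Π A σ) (bodyAtoms r) →
            Derives Π A (headPred r) (map σ (headArgs r))

  BodySat : (Π : Program) (A : Data) {k : ℕ} → (Fin k → ℕ) → BodyAtom k → Set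
  BodySat Π A σ (edb α)    = mapAtom σ α ∈ A
  BodySat Π A σ (idb p xs) = Derives Π A p (map σ xs)
  BodySat Π A σ (eqb i j)  = σ i ≡ σ j

NDLRewComplete : {n : ℕ} → CQ n → Ontology → Program → ℕ → Set₁
NDLRewComplete q T Π g = Nonrecursive Π × ((A : Data) → Complete T A → (a : Tuple _) → a ⊆ind A →
  (EntailsQ T A q a → Derives Π A g (VF.toList a)) × (Derives Π A g (VF.toList a) → EntailsQ T A q a))

NDLRewArbitrary : {n : ℕ} → CQ n → Ontology → Program → ℕ → Set₁
NDLRewArbitrary q T Π g = Nonrecursive Π × ((A : Data) → (a : Tuple _) → a ⊆ind A →
  (EntailsQ T A q a → Derives Π A g (VF.toList a)) × (Derives Π A g (VF.toList a) → EntailsQ T A q a))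

module Submission where

-- Over arbitrary data we evaluate the given rewriting on the completion of A: A
-- together with the ground atoms over ind(A) entailed by T and A. As every tgd
-- has one body atom and at most two variables, T, A ⊨ S(a, b) depends on a single
-- atom of A: it holds iff S(a, b) ∈ A or some R(z1, z2) ∈ A reaches, in a finite
-- graph of shapes (atoms over z1, z2 and one anonymous element) built from T
-- alone, a shape instantiating to S(a, b); completeness of this test is read off
-- the chase in which all labelled nulls are identified. So membership in the
-- completion is defined over A by a positive existential formula of size
-- O(|T|), which we substitute for every atom of the rewriting; for datalog the
-- completion is computed by O(|T|) nonrecursive rules, one IDB predicate per
-- strongly connected class of the shape graph.

open import Defs
open import Data.Nat using (ℕ; zero; suc; _+_; _*_; _≤_; _<_; z≤n; s≤s)
import Data.Nat as ℕ
import Data.Nat.Properties as ℕₚ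
open import Data.Nat.ListAction using (sum)
import Data.Nat.ListAction.Properties as Sumₚ
open import Data.Nat.Tactic.RingSolver using (solve-∀)
open import Data.Fin using (Fin; zero; suc)
import Data.Fin as Fin
open import Data.List using (List; []; _∷_; map; length; concatMap; _++_; filter)
import Data.List.Properties as Listₚ
open import Data.List.Relation.Unary.Any as Any using (Any; here; there)
open import Data.List.Relation.Unary.All as All using (All; []; _∷_)
import Data.List.Relation.Unary.All.Properties as Allₚ
open import Data.List.Membership.Propositional using (_∈_; find; lose)
import Data.List.Membership.Propositional.Properties as ∈ₚ
import Data.List.Membership.DecPropositional ℕ._≟_ as ∈ℕ
open import Data.List.Extrema.Nat using (max; ⊥≤max; xs≤max)
open import Data.Product using (Σ; ∃; _×_; _,_; proj₁; proj₂)
open import Data.Product.Function.NonDependent.Propositional using (_×-⇔_)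
open import Data.Sum using (_⊎_; inj₁; inj₂; [_,_]′)
open import Data.Sum.Function.Propositional using (_⊎-⇔_)
open import Data.Empty using (⊥; ⊥-elim)
import Data.Vec.Functional as VF
open import Function using (_⇔_; mk⇔; Equivalence)
open import Function.Related.TypeIsomorphisms using (¬-cong-⇔)
open import Level using (0ℓ)
open import Relation.Binary using (Rel; Decidable; DecidableEquality)
open import Relation.Binary.PropositionalEquality
open import Relation.Binary.Construct.Closure.ReflexiveTransitive using (Star; ε; _◅_; _◅◅_)
open import Relation.Nullary using (Dec; yes; no; ¬_)
open import Relation.Nullary.Decidable using (map′; from-yes; _×-dec_; _⊎-dec_; _→-dec_; ¬?)
import Data.Sum as Sum

open Equivalence using (to; from)

count : {X : Set} {P : X → Set} → (∀ x → Dec (P x)) → List X → ℕ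
count P? [] = 0
count P? (x ∷ xs) with P? x
... | yes _ = suc (count P? xs)
... | no _ = count P? xs

module _ {X : Set} {P Q : X → Set} (P? : ∀ x → Dec (P x)) (Q? : ∀ x → Dec (Q x)) (P⇒Q : ∀ x → P x → Q x) where

  count-mono : (xs : List X) → count P? xs ≤ count Q? xs
  count-mono [] = z≤n
  count-mono (x ∷ xs) with P? x | Q? x
  ... | yes _ | yes _ = s≤s (count-mono xs)
  ... | yes p | no ¬q = ⊥-elim (¬q (P⇒Q x p))
  ... | no _ | yes _ = ℕₚ.m≤n⇒m≤1+n (count-mono xs)
  ... | no _ | no _ = count-mono xs

  count-mono-< : (xs : List X) → Any (λ x → Q x × ¬ P x) xs → count P? xs < count Q? xs
  count-mono-< (x ∷ xs) (here (q , ¬p)) with P? x | Q? x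
  ... | yes p | _ = ⊥-elim (¬p p)
  ... | no _ | yes _ = s≤s (count-mono xs)
  ... | no _ | no ¬q = ⊥-elim (¬q q)
  count-mono-< (x ∷ xs) (there qxs) with P? x | Q? x
  ... | yes _ | yes _ = s≤s (count-mono-< xs qxs)
  ... | yes p | no ¬q = ⊥-elim (¬q (P⇒Q x p))
  ... | no _ | yes _ = ℕₚ.m≤n⇒m≤1+n (count-mono-< xs qxs)
  ... | no _ | no _ = count-mono-< xs qxs

count≤length : {X : Set} {P : X → Set} (P? : ∀ x → Dec (P x)) (xs : List X) → count P? xs ≤ length xs
count≤length P? [] = z≤n
count≤length P? (x ∷ xs) with P? x
... | yes _ = s≤s (count≤length P? xs)
... | no _ = ℕₚ.m≤n⇒m≤1+n (count≤length P? xs)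

count-cong : {X : Set} {P Q : X → Set} (P? : ∀ x → Dec (P x)) (Q? : ∀ x → Dec (Q x)) →
  (∀ x → P x → Q x) → (∀ x → Q x → P x) → (xs : List X) → count P? xs ≡ count Q? xs
count-cong P? Q? P⇒Q Q⇒P xs = ℕₚ.≤-antisym (count-mono P? Q? P⇒Q xs) (count-mono Q? P? Q⇒P xs)

firstIndex : {X : Set} {P : X → Set} → (∀ x → Dec (P x)) → List X → ℕ
firstIndex P? [] = 0
firstIndex P? (x ∷ xs) with P? x
... | yes _ = 0
... | no _ = suc (firstIndex P? xs)

firstIndex-cong : {X : Set} {P Q : X → Set} (P? : ∀ x → Dec (P x)) (Q? : ∀ x → Dec (Q x)) →
  (∀ x → P x → Q x) → (∀ x → Q x → P x) → (xs : List X) → firstIndex P? xs ≡ firstIndex Q? xs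
firstIndex-cong P? Q? P⇒Q Q⇒P [] = refl
firstIndex-cong P? Q? P⇒Q Q⇒P (x ∷ xs) with P? x | Q? x
... | yes _ | yes _ = refl
... | yes p | no ¬q = ⊥-elim (¬q (P⇒Q x p))
... | no ¬p | yes q = ⊥-elim (¬p (Q⇒P x q))
... | no _ | no _ = cong suc (firstIndex-cong P? Q? P⇒Q Q⇒P xs)

firstIndex<length : {X : Set} {P : X → Set} (P? : ∀ x → Dec (P x)) (xs : List X) → Any P xs → firstIndex P? xs < length xs
firstIndex<length P? (x ∷ xs) pxs with P? x | pxs
... | yes _ | _ = s≤s z≤n
... | no ¬p | here p = ⊥-elim (¬p p)
... | no _ | there pxs′ = s≤s (firstIndex<length P? xs pxs′)

firstIndex-≡⇒∃ : {X : Set} {P Q : X → Set} (P? : ∀ x → Dec (P x)) (Q? : ∀ x → Dec (Q x)) (xs : List X) →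
  firstIndex P? xs ≡ firstIndex Q? xs → Any P xs → ∃ λ x → P x × Q x
firstIndex-≡⇒∃ P? Q? (x ∷ xs) same pxs with P? x | Q? x | same | pxs
... | yes p | yes q | _ | _ = x , p , q
... | yes _ | no _ | () | _
... | no _ | yes _ | () | _
... | no ¬p | no _ | _ | here p = ⊥-elim (¬p p)
... | no _ | no _ | same′ | there pxs′ = firstIndex-≡⇒∃ P? Q? xs (ℕₚ.suc-injective same′) pxs′

-- Reachability within k steps is decidable, and it stabilises after
-- |targets| + 2 rounds, since every round that does not close the reached set
-- adds a new node.
module Reachability {X : Set} (_≟_ : DecidableEquality X) {E : Rel X 0ℓ} (E? : Decidable E)
                    (targets : List X) (target∈ : ∀ {u t} → E u t → t ∈ targets) where

  module _ (s : X) where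
    nodes : List X
    nodes = s ∷ targets

    Within : ℕ → X → Set
    Within zero t = s ≡ t
    Within (suc k) t = Within k t ⊎ Any (λ u → Within k u × E u t) nodes

    within? : ∀ k t → Dec (Within k t)
    within? zero t = s ≟ t
    within? (suc k) t = within? k t ⊎-dec Any.any? (λ u → within? k u ×-dec E? u t) nodes

    within⇒star : ∀ k {t} → Within k t → Star E s t
    within⇒star zero refl = ε
    within⇒star (suc k) (inj₁ w) = within⇒star k w
    within⇒star (suc k) (inj₂ steps) with Any.satisfied steps
    ... | u , w , e = within⇒star k w ◅◅ (e ◅ ε)

    within-refl : ∀ k → Within k s
    within-refl zero = refl
    within-refl (suc k) = inj₁ (within-refl k)

    within∈nodes : ∀ k {t} → Within k t → t ∈ nodes
    within∈nodes zero refl = here refl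
    within∈nodes (suc k) (inj₁ w) = within∈nodes k w
    within∈nodes (suc k) (inj₂ steps) with Any.satisfied steps
    ... | u , w , e = there (target∈ e)

    Closed : ℕ → Set
    Closed k = ∀ {u t} → Within k u → E u t → Within k t

    closed-suc : ∀ k → Closed k → Closed (suc k)
    closed-suc k closed w e = inj₁ (closed (stable w) e)
      where
      stable : ∀ {t} → Within (suc k) t → Within k t
      stable (inj₁ w′) = w′
      stable (inj₂ steps) with Any.satisfied steps
      ... | u , w′ , e′ = closed w′ e′

    closed-if-stable : ∀ k → All (λ t → Within (suc k) t → Within k t) nodes → Closed k
    closed-if-stable k stable {u} {t} w e = All.lookup stable (within∈nodes (suc k) w′) w′
      where
      w′ : Within (suc k) t
      w′ = inj₂ (Any.map (λ { refl → w , e }) (within∈nodes k w))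

    newNode : ∀ k (xs : List X) → ¬ All (λ t → Within (suc k) t → Within k t) xs →
      Any (λ t → Within (suc k) t × ¬ Within k t) xs
    newNode k [] ¬stable = ⊥-elim (¬stable [])
    newNode k (x ∷ xs) ¬stable with within? (suc k) x | within? k x
    ... | yes w₊ | no ¬w = here (w₊ , ¬w)
    ... | yes _ | yes w = there (newNode k xs λ st → ¬stable ((λ _ → w) ∷ st))
    ... | no ¬w₊ | _ = there (newNode k xs λ st → ¬stable ((λ w₊ → ⊥-elim (¬w₊ w₊)) ∷ st))

    reached : ℕ → ℕ
    reached k = count (within? k) nodes

    grows-or-closed : ∀ k → k ≤ reached k ⊎ Closed k
    grows-or-closed zero = inj₁ z≤n
    grows-or-closed (suc k) with grows-or-closed k
    ... | inj₂ closed = inj₂ (closed-suc k closed)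
    ... | inj₁ k≤ with All.all? (λ t → within? (suc k) t →-dec within? k t) nodes
    ...   | yes stable = inj₂ (closed-suc k (closed-if-stable k stable))
    ...   | no ¬stable = inj₁ (ℕₚ.≤-trans (s≤s k≤)
              (count-mono-< (within? k) (within? (suc k)) (λ _ → inj₁) nodes (newNode k nodes ¬stable)))

    rounds : ℕ
    rounds = suc (length nodes)

    closed : Closed rounds
    closed with grows-or-closed rounds
    ... | inj₂ c = c
    ... | inj₁ le = ⊥-elim (ℕₚ.1+n≰n (ℕₚ.≤-trans le (count≤length (within? rounds) nodes)))

    star⇒within : ∀ {u t} → Within rounds u → Star E u t → Within rounds t
    star⇒within w ε = w
    star⇒within w (e ◅ es) = star⇒within (closed w e) es

  star? : Decidable (Star E)
  star? s t = map′ (within⇒star s (rounds s)) (star⇒within s (within-refl s (rounds s))) (within? s (rounds s) t)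

predSym : {V : Set} → Atom V → ℕ
predSym (un p _) = p
predSym (bin p _ _) = p

un-injective : ∀ {V : Set} {p q} {a b : V} → un p a ≡ un q b → p ≡ q × a ≡ b
un-injective refl = refl , refl

bin-injective : ∀ {V : Set} {p q} {a b c d : V} → bin p a b ≡ bin q c d → p ≡ q × a ≡ c × b ≡ d
bin-injective refl = refl , refl , refl

atom-≟ : {V : Set} → DecidableEquality V → DecidableEquality (Atom V)
atom-≟ _≟_ (un p a) (un q b) with p ℕ.≟ q | a ≟ b
... | yes refl | yes refl = yes refl
... | no p≢q | _ = no λ e → p≢q (proj₁ (un-injective e))
... | yes _ | no a≢b = no λ e → a≢b (proj₂ (un-injective e))
atom-≟ _≟_ (un _ _) (bin _ _ _) = no λ ()
atom-≟ _≟_ (bin _ _ _) (un _ _) = no λ ()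
atom-≟ _≟_ (bin p a b) (bin q c d) with p ℕ.≟ q | a ≟ c | b ≟ d
... | yes refl | yes refl | yes refl = yes refl
... | no p≢q | _ | _ = no λ e → p≢q (proj₁ (bin-injective e))
... | yes _ | no a≢c | _ = no λ e → a≢c (proj₁ (proj₂ (bin-injective e)))
... | yes _ | yes _ | no b≢d = no λ e → b≢d (proj₂ (proj₂ (bin-injective e)))

predSym-mapAtom : {V W : Set} (f : V → W) (α : Atom V) → predSym (mapAtom f α) ≡ predSym α
predSym-mapAtom f (un p v) = refl
predSym-mapAtom f (bin p v w) = refl

termsOf-mapAtom : {V W : Set} (f : V → W) (α : Atom V) → termsOf (mapAtom f α) ≡ map f (termsOf α)
termsOf-mapAtom f (un p v) = refl
termsOf-mapAtom f (bin p v w) = refl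

mapAtom-cong : {V W : Set} (f g : V → W) (α : Atom V) → (∀ x → x ∈ termsOf α → f x ≡ g x) → mapAtom f α ≡ mapAtom g α
mapAtom-cong f g (un p v) f≗g = cong (un p) (f≗g v (here refl))
mapAtom-cong f g (bin p v w) f≗g = cong₂ (bin p) (f≗g v (here refl)) (f≗g w (there (here refl)))

mapAtom-≡⇒≗ : {V W : Set} (f g : V → W) (α : Atom V) → mapAtom f α ≡ mapAtom g α → ∀ x → x ∈ termsOf α → f x ≡ g x
mapAtom-≡⇒≗ f g (un p v) same x (here refl) = proj₂ (un-injective same)
mapAtom-≡⇒≗ f g (bin p v w) same x (here refl) = proj₁ (proj₂ (bin-injective same))
mapAtom-≡⇒≗ f g (bin p v w) same x (there (here refl)) = proj₂ (proj₂ (bin-injective same))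

mapAtom-∘ : {U V W : Set} (f : V → W) (g : U → V) (α : Atom U) → mapAtom f (mapAtom g α) ≡ mapAtom (λ x → f (g x)) α
mapAtom-∘ f g (un p v) = refl
mapAtom-∘ f g (bin p v w) = refl

HoldsA-mapAtom : (I : Interp) {V W : Set} (ρ : W → Dom I) (f : V → W) (α : Atom V) →
  HoldsA I ρ (mapAtom f α) ≡ HoldsA I (λ x → ρ (f x)) α
HoldsA-mapAtom I ρ f (un p v) = refl
HoldsA-mapAtom I ρ f (bin p v w) = refl

HoldsA-cong : (I : Interp) {V : Set} (f g : V → Dom I) (α : Atom V) →
  (∀ v → v ∈ termsOf α → f v ≡ g v) → HoldsA I f α → HoldsA I g α
HoldsA-cong I f g (un p v) f≗g h = subst (UI I p) (f≗g v (here refl)) h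
HoldsA-cong I f g (bin p v w) f≗g h = subst₂ (BI I p) (f≗g v (here refl)) (f≗g w (there (here refl))) h

ifDec : {P B : Set} → Dec P → B → B → B
ifDec (yes _) x y = x
ifDec (no _) x y = y

ifDec-yes : {P B : Set} (d : Dec P) {x y : B} → P → ifDec d x y ≡ x
ifDec-yes (yes _) p = refl
ifDec-yes (no ¬p) p = ⊥-elim (¬p p)

ifDec-no : {P B : Set} (d : Dec P) {x y : B} → ¬ P → ifDec d x y ≡ y
ifDec-no (yes p) ¬p = ⊥-elim (¬p p)
ifDec-no (no _) ¬p = refl

ifDec-elim : {P B : Set} (d : Dec P) {x y z : B} → (P → x ≡ z) → y ≡ z → ifDec d x y ≡ z
ifDec-elim (yes p) x≡z y≡z = x≡z p
ifDec-elim (no _) x≡z y≡z = y≡z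

-- A shape is an atom over the positions of a data atom: its first constant c₁,
-- its second constant c₂, and one anonymous element c∗. Since every tgd has at
-- most two variables, a derivation starting from one data atom only ever needs
-- the two constants of that atom plus the anonymous element created last.
Shape : Set
Shape = Atom (Fin 3)

pattern c₁ = zero
pattern c₂ = suc zero
pattern c∗ = suc (suc zero)

IsConst : Fin 3 → Set
IsConst i = ¬ i ≡ c∗

-- Atoms with only anonymous arguments are irrelevant for ground consequences,
-- so bodies are matched only against shapes containing a constant.
binShapes : {v w : Fin 2} → ℕ → Dec (v ≡ w) → List Shape
binShapes p (yes _) = bin p c₁ c₁ ∷ bin p c₂ c₂ ∷ []
binShapes p (no _) = bin p c₁ c₁ ∷ bin p c₁ c₂ ∷ bin p c₁ c∗ ∷ bin p c₂ c₁ ∷ bin p c₂ c₂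
                   ∷ bin p c₂ c∗ ∷ bin p c∗ c₁ ∷ bin p c∗ c₂ ∷ []

bodyShapes : Atom (Fin 2) → List Shape
bodyShapes (un p v) = un p c₁ ∷ un p c₂ ∷ []
bodyShapes (bin p v w) = binShapes p (v Fin.≟ w)

-- Existential variables of a tgd land on the anonymous element, which is thereby
-- reused for the fresh null.
varPos : Atom (Fin 2) → Shape → Fin 2 → Fin 3
varPos (un p v) (un q i) x = ifDec (x Fin.≟ v) i c∗
varPos (bin p v w) (bin q i j) x = ifDec (x Fin.≟ v) i (ifDec (x Fin.≟ w) j c∗)
varPos _ _ x = c∗

withNull : {D : Set} → (Fin 3 → D) → D → Fin 3 → D
withNull ρ d c₁ = ρ c₁
withNull ρ d c₂ = ρ c₂
withNull ρ d c∗ = d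

withNull-const : {D : Set} (ρ : Fin 3 → D) (d : D) (i : Fin 3) → IsConst i → withNull ρ d i ≡ ρ i
withNull-const ρ d c₁ _ = refl
withNull-const ρ d c₂ _ = refl
withNull-const ρ d c∗ i≢c∗ = ⊥-elim (i≢c∗ refl)

withNull-self : {D : Set} (ρ : Fin 3 → D) (i : Fin 3) → withNull ρ (ρ c∗) i ≡ ρ i
withNull-self ρ c₁ = refl
withNull-self ρ c₂ = refl
withNull-self ρ c∗ = refl

other : Fin 2 → Fin 2
other zero = suc zero
other (suc zero) = zero

≢⇒≡other : (x v : Fin 2) → ¬ x ≡ v → x ≡ other v
≢⇒≡other zero zero x≢v = ⊥-elim (x≢v refl)
≢⇒≡other zero (suc zero) _ = refl
≢⇒≡other (suc zero) zero _ = refl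
≢⇒≡other (suc zero) (suc zero) x≢v = ⊥-elim (x≢v refl)

≢⇒either : (x v w : Fin 2) → ¬ v ≡ w → x ≡ v ⊎ x ≡ w
≢⇒either x v w v≢w with x Fin.≟ v
... | yes x≡v = inj₁ x≡v
... | no x≢v = inj₂ (trans (≢⇒≡other x v x≢v) (sym (≢⇒≡other w v λ w≡v → v≢w (sym w≡v))))

unShape⁻ : ∀ {p v u} → u ∈ bodyShapes (un p v) → Σ (Fin 3) λ i → IsConst i × u ≡ un p i
unShape⁻ (here refl) = c₁ , (λ ()) , refl
unShape⁻ (there (here refl)) = c₂ , (λ ()) , refl

reflShape⁻ : ∀ {p u} {v w : Fin 2} (v≡w : v ≡ w) → u ∈ binShapes p (yes v≡w) → Σ (Fin 3) λ i → IsConst i × u ≡ bin p i i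
reflShape⁻ _ (here refl) = c₁ , (λ ()) , refl
reflShape⁻ _ (there (here refl)) = c₂ , (λ ()) , refl

binShape⁻ : ∀ {p u} {v w : Fin 2} (v≢w : ¬ v ≡ w) → u ∈ binShapes p (no v≢w) → Σ (Fin 3) λ i → Σ (Fin 3) λ j → u ≡ bin p i j
binShape⁻ _ (here refl) = _ , _ , refl
binShape⁻ _ (there (here refl)) = _ , _ , refl
binShape⁻ _ (there (there (here refl))) = _ , _ , refl
binShape⁻ _ (there (there (there (here refl)))) = _ , _ , refl
binShape⁻ _ (there (there (there (there (here refl))))) = _ , _ , refl
binShape⁻ _ (there (there (there (there (there (here refl)))))) = _ , _ , refl
binShape⁻ _ (there (there (there (there (there (there (here refl))))))) = _ , _ , refl
binShape⁻ _ (there (there (there (there (there (there (there (here refl)))))))) = _ , _ , refl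

varPos-body : (b : Atom (Fin 2)) {u : Shape} → u ∈ bodyShapes b → mapAtom (varPos b u) b ≡ u
varPos-body (un p v) u∈ with unShape⁻ {p} {v} u∈
... | i , _ , refl = cong (un p) (ifDec-yes (v Fin.≟ v) refl)
varPos-body (bin p v w) u∈ with v Fin.≟ w
... | yes v≡w with reflShape⁻ {p} v≡w u∈
...   | i , _ , refl = cong₂ (bin p) (ifDec-yes (v Fin.≟ v) refl)
                         (ifDec-elim (w Fin.≟ v) (λ _ → refl) (ifDec-yes (w Fin.≟ w) refl))
varPos-body (bin p v w) u∈ | no v≢w with binShape⁻ {p} v≢w u∈
...   | i , j , refl = cong₂ (bin p) (ifDec-yes (v Fin.≟ v) refl)
                         (trans (ifDec-no (w Fin.≟ v) (λ w≡v → v≢w (sym w≡v))) (ifDec-yes (w Fin.≟ w) refl))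

-- Only a variable outside the body is sent to c∗, so σ′ may differ from the body
-- match there alone.
varPos-extension : ∀ {D : Set} (b : Atom (Fin 2)) (u : Shape) → u ∈ bodyShapes b → (ρ : Fin 3 → D) (σ′ : Fin 2 → D) →
  (∀ x → x ∈ termsOf b → σ′ x ≡ ρ (varPos b u x)) → Σ D λ d → ∀ x → σ′ x ≡ withNull ρ d (varPos b u x)
varPos-extension (un p v) u u∈ ρ σ′ agree with unShape⁻ {p} {v} u∈
... | i , i-const , refl = σ′ (other v) , λ x → onVar x (x Fin.≟ v)
  where
  onVar : ∀ x → Dec (x ≡ v) → σ′ x ≡ withNull ρ (σ′ (other v)) (ifDec (x Fin.≟ v) i c∗)
  onVar x (yes x≡v) = trans (agree x (here x≡v)) (trans (cong ρ (ifDec-yes (x Fin.≟ v) x≡v))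
                        (sym (trans (cong (withNull ρ _) (ifDec-yes (x Fin.≟ v) x≡v)) (withNull-const ρ _ i i-const))))
  onVar x (no x≢v) = trans (cong σ′ (≢⇒≡other x v x≢v)) (cong (withNull ρ _) (sym (ifDec-no (x Fin.≟ v) x≢v)))
varPos-extension (bin p v w) u u∈ ρ σ′ agree with v Fin.≟ w
... | yes refl with reflShape⁻ {p} {v = v} {w = v} refl u∈
...   | i , i-const , refl = σ′ (other v) , λ x → onVar x (x Fin.≟ v)
  where
  onVar : ∀ x → Dec (x ≡ v) → σ′ x ≡ withNull ρ (σ′ (other v)) (ifDec (x Fin.≟ v) i (ifDec (x Fin.≟ v) i c∗))
  onVar x (yes x≡v) = trans (agree x (here x≡v)) (trans (cong ρ (ifDec-yes (x Fin.≟ v) x≡v))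
                        (sym (trans (cong (withNull ρ _) (ifDec-yes (x Fin.≟ v) x≡v)) (withNull-const ρ _ i i-const))))
  onVar x (no x≢v) = trans (cong σ′ (≢⇒≡other x v x≢v))
     (cong (withNull ρ _) (sym (trans (ifDec-no (x Fin.≟ v) x≢v) (ifDec-no (x Fin.≟ v) x≢v))))
varPos-extension (bin p v w) u u∈ ρ σ′ agree | no v≢w with binShape⁻ {p} v≢w u∈
...   | i , j , refl = ρ c∗ , λ x → trans (agree x (inBody x (≢⇒either x v w v≢w))) (sym (withNull-self ρ _))
  where
  inBody : ∀ x → x ≡ v ⊎ x ≡ w → x ∈ termsOf (bin p v w)
  inBody x (inj₁ x≡v) = here x≡v
  inBody x (inj₂ x≡w) = there (here x≡w)

module ShapeGraph (T : Ontology) where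

  TGDStep : TGD → Shape → Shape → Set
  TGDStep τ u t = u ∈ bodyShapes (body τ) × t ∈ map (mapAtom (varPos (body τ) u)) (head τ)

  Step : Shape → Shape → Set
  Step u t = Any (λ τ → TGDStep τ u t) T

  Path : Shape → Shape → Set
  Path = Star Step

  step? : ∀ u t → Dec (Step u t)
  step? u t = Any.any? (λ τ → (u ∈? bodyShapes (body τ)) ×-dec (t ∈? map (mapAtom (varPos (body τ) u)) (head τ))) T
    where open import Data.List.Membership.DecPropositional (atom-≟ Fin._≟_) using (_∈?_)

  stepTargets : List Shape
  stepTargets = concatMap (λ τ → concatMap (λ u → map (mapAtom (varPos (body τ) u)) (head τ)) (bodyShapes (body τ))) T

  step-target : ∀ {u t} → Step u t → t ∈ stepTargets
  step-target s = ∈ₚ.∈-concatMap⁺ _ {xs = T}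
    (Any.map (λ { (u∈ , t∈) → ∈ₚ.∈-concatMap⁺ _ (Any.map (λ { refl → t∈ }) u∈) }) s)

  path? : ∀ u t → Dec (Path u t)
  path? = Reachability.star? (atom-≟ Fin._≟_) step? stepTargets step-target

module PathSoundness (T : Ontology) (I : Interp) (I⊨T : ModelT I T) where
  open ShapeGraph T

  tgd-step-sound : (τ : TGD) → SatTGD I τ → (ρ : Fin 3 → Dom I) {u t : Shape} → TGDStep τ u t →
    HoldsA I ρ u → Σ (Dom I) λ d → HoldsA I (withNull ρ d) t
  tgd-step-sound τ sat ρ {u} (u∈ , t∈) holds-u
    with sat (λ x → ρ (varPos (body τ) u x))
             (subst (λ X → X) (HoldsA-mapAtom I ρ (varPos (body τ) u) (body τ))
               (subst (HoldsA I ρ) (sym (varPos-body (body τ) u∈)) holds-u))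
  ... | σ′ , agree , heads with varPos-extension (body τ) u u∈ ρ σ′ agree | ∈ₚ.∈-map⁻ (mapAtom (varPos (body τ) u)) t∈
  ...   | d , σ′≡ | h , h∈ , refl = d , subst (λ X → X) (sym (HoldsA-mapAtom I (withNull ρ d) (varPos (body τ) u) h))
            (HoldsA-cong I σ′ _ h (λ x _ → σ′≡ x) (All.lookup heads h∈))

  step-sound : (ρ : Fin 3 → Dom I) {u t : Shape} → Step u t → HoldsA I ρ u → Σ (Dom I) λ d → HoldsA I (withNull ρ d) t
  step-sound ρ s with All.lookupAny I⊨T s
  ... | sat , st = tgd-step-sound (Any.lookup s) sat ρ st

  path-sound : (ρ : Fin 3 → Dom I) {s t : Shape} → Path s t → HoldsA I ρ s →
    Σ (Fin 3 → Dom I) λ ρ′ → ρ′ c₁ ≡ ρ c₁ × ρ′ c₂ ≡ ρ c₂ × HoldsA I ρ′ t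
  path-sound ρ ε holds = ρ , refl , refl , holds
  path-sound ρ (e ◅ es) holds with step-sound ρ e holds
  ... | d , holds′ = path-sound (withNull ρ d) es holds′

-- The chase of A with all labelled nulls collapsed into one element anon. It is
-- still a model of T, as tgd heads only ask for some witness, and each of its
-- atoms is all-anonymous or comes from one data atom along a path of the shape
-- graph (chase-explained).
data CTerm : Set where
  const : ℕ → CTerm
  anon : CTerm

const-injective : ∀ {a b} → const a ≡ const b → a ≡ b
const-injective refl = refl

mapAtom-const-injective : {α β : Atom ℕ} → mapAtom const α ≡ mapAtom const β → α ≡ β
mapAtom-const-injective {un p a} {un .p b} refl = refl
mapAtom-const-injective {bin p a b} {bin .p c d} refl = refl

fstConst sndConst : Atom ℕ → ℕ
fstConst (un p a) = a
fstConst (bin p a b) = a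
sndConst (un p a) = a
sndConst (bin p a b) = b

-- The value at c∗ is arbitrary: ground is only used on entry shapes and ground
-- shapes, which do not contain c∗.
ground : ℕ → ℕ → Fin 3 → ℕ
ground z1 z2 c₁ = z1
ground z1 z2 c₂ = z2
ground z1 z2 c∗ = z1

termsAt : Atom ℕ → Fin 3 → CTerm
termsAt γ c₁ = const (fstConst γ)
termsAt γ c₂ = const (sndConst γ)
termsAt γ c∗ = anon

termsAt-const : (γ : Atom ℕ) (i : Fin 3) → IsConst i → termsAt γ i ≡ const (ground (fstConst γ) (sndConst γ) i)
termsAt-const γ c₁ n = refl
termsAt-const γ c₂ n = refl
termsAt-const γ c∗ n = ⊥-elim (n refl)

termsAt-anon : (γ : Atom ℕ) (i : Fin 3) → termsAt γ i ≡ anon → i ≡ c∗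
termsAt-anon γ c₁ ()
termsAt-anon γ c₂ ()
termsAt-anon γ c∗ e = refl

InjectiveOn : (Fin 3 → CTerm) → Shape → Set
InjectiveOn π β = ∀ x y → x ∈ termsOf β → y ∈ termsOf β → π x ≡ π y → x ≡ y

binShapeOf : ∀ {a b : ℕ} → ℕ → Dec (a ≡ b) → Shape
binShapeOf p (yes _) = bin p c₁ c₁
binShapeOf p (no _) = bin p c₁ c₂

shapeOf : Atom ℕ → Shape
shapeOf (un p a) = un p c₁
shapeOf (bin p a b) = binShapeOf p (a ℕ.≟ b)

shapeOf-termsAt : (γ : Atom ℕ) → mapAtom (termsAt γ) (shapeOf γ) ≡ mapAtom const γ × InjectiveOn (termsAt γ) (shapeOf γ)
shapeOf-termsAt (un p a) = refl , λ { x y (here refl) (here refl) e → refl }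
shapeOf-termsAt (bin p a b) with a ℕ.≟ b
... | yes refl = refl , λ { x y (here refl) (here refl) e → refl
                          ; x y (here refl) (there (here refl)) e → refl
                          ; x y (there (here refl)) (here refl) e → refl
                          ; x y (there (here refl)) (there (here refl)) e → refl }
... | no ne = refl , λ { x y (here refl) (here refl) e → refl
                       ; x y (here refl) (there (here refl)) e → ⊥-elim (ne (const-injective e))
                       ; x y (there (here refl)) (here refl) e → ⊥-elim (ne (sym (const-injective e)))
                       ; x y (there (here refl)) (there (here refl)) e → refl }

shapeOf-ground : (γ : Atom ℕ) → mapAtom (ground (fstConst γ) (sndConst γ)) (shapeOf γ) ≡ γ
shapeOf-ground (un p a) = refl
shapeOf-ground (bin p a b) with a ℕ.≟ b
... | yes refl = refl
... | no ne = refl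

predSym-shapeOf : (γ : Atom ℕ) → predSym (shapeOf γ) ≡ predSym γ
predSym-shapeOf (un p a) = refl
predSym-shapeOf (bin p a b) with a ℕ.≟ b
... | yes _ = refl
... | no _ = refl

predSym-bodyShape : (b : Atom (Fin 2)) {u : Shape} → u ∈ bodyShapes b → predSym u ≡ predSym b
predSym-bodyShape (un p v) m with unShape⁻ {p} {v} m
... | _ , _ , refl = refl
predSym-bodyShape (bin p v w) m with v Fin.≟ w
... | yes e with reflShape⁻ {p} e m
...   | _ , _ , refl = refl
predSym-bodyShape (bin p v w) m | no ne with binShape⁻ {p} ne m
...   | _ , _ , refl = refl

∈binShapes : ∀ {p} {v w : Fin 2} (v≟w : Dec (v ≡ w)) (i j : Fin 3) → (v ≡ w → i ≡ j) → ¬ (i ≡ c∗ × j ≡ c∗) →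
  bin p i j ∈ binShapes p v≟w
∈binShapes (yes v≡w) i j diagonal notAnon with diagonal v≡w
∈binShapes (yes _) c₁ c₁ _ _ | refl = here refl
∈binShapes (yes _) c₂ c₂ _ _ | refl = there (here refl)
∈binShapes (yes _) c∗ c∗ _ notAnon | refl = ⊥-elim (notAnon (refl , refl))
∈binShapes (no _) c₁ c₁ _ _ = here refl
∈binShapes (no _) c₁ c₂ _ _ = there (here refl)
∈binShapes (no _) c₁ c∗ _ _ = there (there (here refl))
∈binShapes (no _) c₂ c₁ _ _ = there (there (there (here refl)))
∈binShapes (no _) c₂ c₂ _ _ = there (there (there (there (here refl))))
∈binShapes (no _) c₂ c∗ _ _ = there (there (there (there (there (here refl)))))
∈binShapes (no _) c∗ c₁ _ _ = there (there (there (there (there (there (here refl))))))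
∈binShapes (no _) c∗ c₂ _ _ = there (there (there (there (there (there (there (here refl)))))))
∈binShapes (no _) c∗ c∗ _ notAnon = ⊥-elim (notAnon (refl , refl))

data BodyMatch (b : Atom (Fin 2)) (βh : Shape) (σ : Fin 2 → CTerm) : Set where
  anonymous : (∀ x → x ∈ termsOf b → σ x ≡ anon) → BodyMatch b βh σ
  viaShape : βh ∈ bodyShapes b → BodyMatch b βh σ

-- Injectivity is what rules out matching a body R(x,x) against R(c₁,c₂).
bodyMatch : (γ : Atom ℕ) (b : Atom (Fin 2)) (βh : Shape) (σ : Fin 2 → CTerm) →
  mapAtom (termsAt γ) βh ≡ mapAtom σ b → InjectiveOn (termsAt γ) βh → BodyMatch b βh σ
bodyMatch γ (un p v) (un q c₁) σ same _ with un-injective same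
... | refl , _ = viaShape (here refl)
bodyMatch γ (un p v) (un q c₂) σ same _ with un-injective same
... | refl , _ = viaShape (there (here refl))
bodyMatch γ (un p v) (un q c∗) σ same _ with un-injective same
... | refl , σv = anonymous λ { x (here refl) → sym σv }
bodyMatch γ (bin p v w) (bin q i j) σ same injective with bin-injective same | (i Fin.≟ c∗) ×-dec (j Fin.≟ c∗)
... | refl , σv , σw | yes (refl , refl) = anonymous λ { x (here refl) → sym σv ; x (there (here refl)) → sym σw }
... | refl , σv , σw | no notAnon = viaShape (∈binShapes (v Fin.≟ w) i j
        (λ { refl → injective i j (here refl) (there (here refl)) (trans σv (sym σw)) }) notAnon)
bodyMatch γ (un _ _) (bin _ _ _) σ () _
bodyMatch γ (bin _ _ _) (un _ _) σ () _

varPos-outside : (b : Atom (Fin 2)) (u : Shape) (x : Fin 2) → ¬ x ∈ termsOf b → varPos b u x ≡ c∗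
varPos-outside (un p v) (un q i) x nm = ifDec-no (x Fin.≟ v) (λ e → nm (here e))
varPos-outside (un p v) (bin q i j) x nm = refl
varPos-outside (bin p v w) (un q i) x nm = refl
varPos-outside (bin p v w) (bin q i j) x nm =
  trans (ifDec-no (x Fin.≟ v) (λ e → nm (here e))) (ifDec-no (x Fin.≟ w) (λ e → nm (there (here e))))

varPos-inside : (b : Atom (Fin 2)) {u : Shape} → u ∈ bodyShapes b → ∀ x → x ∈ termsOf b → varPos b u x ∈ termsOf u
varPos-inside b {u} m x xm = subst (λ a → varPos b u x ∈ termsOf a) (varPos-body b m)
  (subst (varPos b u x ∈_) (sym (termsOf-mapAtom (varPos b u) b)) (∈ₚ.∈-map⁺ (varPos b u) xm))

module CanonicalModel (T : Ontology) (A : Data) where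
  open import Data.List.Membership.DecPropositional (Fin._≟_ {n = 2}) using (_∈?_)
  open ShapeGraph T

  extendAnon : TGD → (Fin 2 → CTerm) → Fin 2 → CTerm
  extendAnon τ σ x = ifDec (x ∈? termsOf (body τ)) (σ x) anon

  data Chase : Atom CTerm → Set where
    fromData : ∀ {α} → α ∈ A → Chase (mapAtom const α)
    fire : ∀ {τ} → τ ∈ T → (σ : Fin 2 → CTerm) → Chase (mapAtom σ (body τ)) → ∀ {h} → h ∈ head τ → Chase (mapAtom (extendAnon τ σ) h)

  canonical : Interp
  canonical = record { Dom = CTerm ; UI = λ p t → Chase (un p t) ; BI = λ p s t → Chase (bin p s t) }

  HoldsA-canonical : {V : Set} (ρ : V → CTerm) (α : Atom V) → HoldsA canonical ρ α ≡ Chase (mapAtom ρ α)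
  HoldsA-canonical ρ (un p v) = refl
  HoldsA-canonical ρ (bin p v w) = refl

  canonical⊨T : ModelT canonical T
  canonical⊨T = All.tabulate λ {τ} τ∈T σ hb → extendAnon τ σ , (λ v vm → ifDec-yes (v ∈? termsOf (body τ)) vm) ,
     All.tabulate (λ {h} hm → subst (λ X → X) (sym (HoldsA-canonical (extendAnon τ σ) h))
        (fire τ∈T σ (subst (λ X → X) (HoldsA-canonical σ (body τ)) hb) hm))

  canonical⊨A : ModelA canonical const A
  canonical⊨A = All.tabulate λ {α} m → subst (λ X → X) (sym (HoldsA-canonical const α)) (fromData m)

  Anonymous : Atom CTerm → Set
  Anonymous β = All (_≡ anon) (termsOf β)

  Explained : Atom CTerm → Set
  Explained β = Anonymous β ⊎ Σ (Atom ℕ) λ γ → γ ∈ A × Σ Shape λ βh → Path (shapeOf γ) βh × mapAtom (termsAt γ) βh ≡ β × InjectiveOn (termsAt γ) βh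

  anonymous-head : (τ : TGD) (σ : Fin 2 → CTerm) (h : Atom (Fin 2)) → (∀ x → x ∈ termsOf (body τ) → σ x ≡ anon) →
    Anonymous (mapAtom (extendAnon τ σ) h)
  anonymous-head τ σ h f = subst (All (_≡ anon)) (sym (termsOf-mapAtom (extendAnon τ σ) h))
    (Allₚ.map⁺ (All.tabulate {xs = termsOf h} λ {x} _ → ifDec-elim (x ∈? termsOf (body τ)) (f x) refl))

  chase-explained : ∀ {β} → Chase β → Explained β
  chase-explained (fromData {α} α∈) = inj₂ (α , α∈ , shapeOf α , ε , shapeOf-termsAt α)
  chase-explained (fire {τ} τ∈ σ body-fact {h} h∈) with chase-explained body-fact
  ... | inj₁ anon-body = inj₁ (anonymous-head τ σ h λ x x∈ → All.lookup anon-body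
          (subst (σ x ∈_) (sym (termsOf-mapAtom σ (body τ))) (∈ₚ.∈-map⁺ σ x∈)))
  ... | inj₂ (γ , γ∈ , u , path , same , injective) with bodyMatch γ (body τ) u σ same injective
  ...   | anonymous anon-body = inj₁ (anonymous-head τ σ h anon-body)
  ...   | viaShape u∈ = inj₂ (γ , γ∈ , t , path ◅◅ (edge ◅ ε) , same′ , injective′)
    where
    b : Atom (Fin 2)
    b = body τ
    t : Shape
    t = mapAtom (varPos b u) h
    agree : ∀ x → x ∈ termsOf b → termsAt γ (varPos b u x) ≡ σ x
    agree = mapAtom-≡⇒≗ _ _ b (trans (sym (mapAtom-∘ (termsAt γ) (varPos b u) b))
              (trans (cong (mapAtom (termsAt γ)) (varPos-body b u∈)) same))
    edge : Step u t
    edge = Any.map (λ { refl → u∈ , ∈ₚ.∈-map⁺ _ h∈ }) τ∈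
    onVar : ∀ x → Dec (x ∈ termsOf b) → termsAt γ (varPos b u x) ≡ extendAnon τ σ x
    onVar x (yes x∈) = trans (agree x x∈) (sym (ifDec-yes (x ∈? termsOf b) x∈))
    onVar x (no x∉) = trans (cong (termsAt γ) (varPos-outside b u x x∉)) (sym (ifDec-no (x ∈? termsOf b) x∉))
    same′ : mapAtom (termsAt γ) t ≡ mapAtom (extendAnon τ σ) h
    same′ = trans (mapAtom-∘ (termsAt γ) (varPos b u) h) (mapAtom-cong _ _ h λ x _ → onVar x (x ∈? termsOf b))
    anonOrOld : ∀ y → y ∈ termsOf t → y ≡ c∗ ⊎ y ∈ termsOf u
    anonOrOld y y∈ with ∈ₚ.∈-map⁻ (varPos b u) (subst (y ∈_) (termsOf-mapAtom (varPos b u) h) y∈)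
    ... | x , _ , refl with x ∈? termsOf b
    ...   | yes x∈ = inj₂ (varPos-inside b u∈ x x∈)
    ...   | no x∉ = inj₁ (varPos-outside b u x x∉)
    injective′ : InjectiveOn (termsAt γ) t
    injective′ x y x∈ y∈ same-term with anonOrOld x x∈ | anonOrOld y y∈
    ... | inj₁ refl | inj₁ refl = refl
    ... | inj₁ refl | inj₂ _ = sym (termsAt-anon γ y (sym same-term))
    ... | inj₂ _ | inj₁ refl = termsAt-anon γ x same-term
    ... | inj₂ x∈u | inj₂ y∈u = injective x y x∈u y∈u same-term

ontPreds : Ontology → List ℕ
ontPreds T = concatMap (λ τ → predSym (body τ) ∷ map predSym (head τ)) T

entryShapes : ℕ → List Shape
entryShapes P = un P c₁ ∷ bin P c₁ c₁ ∷ bin P c₁ c₂ ∷ []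

groundShapes : {V : Set} → Atom V → List Shape
groundShapes (un p _) = un p c₁ ∷ un p c₂ ∷ []
groundShapes (bin p _ _) = bin p c₁ c₁ ∷ bin p c₁ c₂ ∷ bin p c₂ c₁ ∷ bin p c₂ c₂ ∷ []

groundShapes-const : {V : Set} {β : Atom V} {t : Shape} → t ∈ groundShapes β → ∀ x → x ∈ termsOf t → IsConst x
groundShapes-const {β = un p _} (here refl) x (here refl) = λ ()
groundShapes-const {β = un p _} (there (here refl)) x (here refl) = λ ()
groundShapes-const {β = bin p _ _} (here refl) x (here refl) = λ ()
groundShapes-const {β = bin p _ _} (here refl) x (there (here refl)) = λ ()
groundShapes-const {β = bin p _ _} (there (here refl)) x (here refl) = λ ()
groundShapes-const {β = bin p _ _} (there (here refl)) x (there (here refl)) = λ ()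
groundShapes-const {β = bin p _ _} (there (there (here refl))) x (here refl) = λ ()
groundShapes-const {β = bin p _ _} (there (there (here refl))) x (there (here refl)) = λ ()
groundShapes-const {β = bin p _ _} (there (there (there (here refl)))) x (here refl) = λ ()
groundShapes-const {β = bin p _ _} (there (there (there (here refl)))) x (there (here refl)) = λ ()

∈groundShapes : (γ : Atom ℕ) (βh : Shape) (β : Atom ℕ) → mapAtom (termsAt γ) βh ≡ mapAtom const β → βh ∈ groundShapes β
∈groundShapes γ (un p c₁) (un .p b) refl = here refl
∈groundShapes γ (un p c₂) (un .p b) refl = there (here refl)
∈groundShapes γ (un p c∗) (un q b) ()
∈groundShapes γ (bin p c₁ c₁) (bin .p a b) refl = here refl
∈groundShapes γ (bin p c₁ c₂) (bin .p a b) refl = there (here refl)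
∈groundShapes γ (bin p c₂ c₁) (bin .p a b) refl = there (there (here refl))
∈groundShapes γ (bin p c₂ c₂) (bin .p a b) refl = there (there (there (here refl)))
∈groundShapes γ (bin p c∗ j) (bin q a b) ()
∈groundShapes γ (bin p c₁ c∗) (bin q a b) ()
∈groundShapes γ (bin p c₂ c∗) (bin q a b) ()
∈groundShapes γ (un p i) (bin q a b) ()
∈groundShapes γ (bin p i j) (un q a) ()

shapeOf∈entryShapes : (γ : Atom ℕ) → shapeOf γ ∈ entryShapes (predSym γ)
shapeOf∈entryShapes (un p a) = here refl
shapeOf∈entryShapes (bin p a b) with a ℕ.≟ b
... | yes _ = there (here refl)
... | no _ = there (there (here refl))

fstConst∈ : (γ : Atom ℕ) → fstConst γ ∈ termsOf γ
fstConst∈ (un p a) = here refl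
fstConst∈ (bin p a b) = here refl

sndConst∈ : (γ : Atom ℕ) → sndConst γ ∈ termsOf γ
sndConst∈ (un p a) = here refl
sndConst∈ (bin p a b) = there (here refl)

module Entailment (T : Ontology) (A : Data) where
  open ShapeGraph T
  open PathSoundness T
  open CanonicalModel T A

  Witness : Shape → Shape → Atom ℕ → Set
  Witness g t β = Path g t × Σ ℕ λ z1 → Σ ℕ λ z2 → z1 ∈ ind A × z2 ∈ ind A × mapAtom (ground z1 z2) g ∈ A × mapAtom (ground z1 z2) t ≡ β

  Witnessed : Atom ℕ → Set
  Witnessed β = Any (λ P → Any (λ g → Any (λ t → Witness g t β) (groundShapes β)) (entryShapes P)) (ontPreds T)

  Certified : Atom ℕ → Set
  Certified β = β ∈ A ⊎ Witnessed β

  agree-on-consts : {X : Set} (ρ ρ' : Fin 3 → X) → ρ' c₁ ≡ ρ c₁ → ρ' c₂ ≡ ρ c₂ → ∀ x → IsConst x → ρ' x ≡ ρ x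
  agree-on-consts ρ ρ' e1 e2 c₁ n = e1
  agree-on-consts ρ ρ' e1 e2 c₂ n = e2
  agree-on-consts ρ ρ' e1 e2 c∗ n = ⊥-elim (n refl)

  certified-sound : ∀ β → Certified β → Entails T A β
  certified-sound β (inj₁ m) I ι mT mA = All.lookup mA m
  certified-sound β (inj₂ w) I ι mT mA with Any.satisfied w
  ... | P , w2 with Any.satisfied w2
  ...   | g , w3 with find w3
  ...     | t , tm , (r , z1 , z2 , _ , _ , gm , refl)
          with path-sound I mT (λ i → ι (ground z1 z2 i)) r
                 (subst (λ X → X) (HoldsA-mapAtom I ι (ground z1 z2) g) (All.lookup mA gm))
  ...       | ρ' , e1 , e2 , h = subst (λ X → X) (sym (HoldsA-mapAtom I ι (ground z1 z2) t))
                 (HoldsA-cong I ρ' (λ i → ι (ground z1 z2 i)) t (λ x xm → agree-on-consts (λ i → ι (ground z1 z2 i)) ρ' e1 e2 x (groundShapes-const tm x xm)) h)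

  ∈ind : ∀ {γ x} → γ ∈ A → x ∈ termsOf γ → x ∈ ind A
  ∈ind γm xm = ∈ₚ.∈-concatMap⁺ termsOf (lose γm xm)

  entailed⇒certified : ∀ β → Entails T A β → Certified β
  entailed⇒certified β ent with chase-explained (subst (λ X → X) (HoldsA-canonical const β) (ent canonical const canonical⊨T canonical⊨A))
  entailed⇒certified (un p a) ent | inj₁ (() ∷ _)
  entailed⇒certified (bin p a b) ent | inj₁ (() ∷ _)
  ... | inj₂ (γ , γm , βh , ε , e , inj) =
          inj₁ (subst (_∈ A) (mapAtom-const-injective (trans (sym (proj₁ (shapeOf-termsAt γ))) e)) γm)
  ... | inj₂ (γ , γm , βh , r@(x ◅ xs) , e , inj) =
          inj₂ (lose Pm (lose (shapeOf∈entryShapes γ) (lose tIn (r , fstConst γ , sndConst γ , ∈ind γm (fstConst∈ γ) , ∈ind γm (sndConst∈ γ) ,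
                    subst (_∈ A) (sym (shapeOf-ground γ)) γm , κeq))))
    where
    Pm : predSym γ ∈ ontPreds T
    Pm = ∈ₚ.∈-concatMap⁺ _ {xs = T} (Any.map (λ { {τ} (m , _) → here (trans (sym (predSym-shapeOf γ)) (predSym-bodyShape (body τ) m)) }) x)
    tIn : βh ∈ groundShapes β
    tIn = ∈groundShapes γ βh β e
    κeq : mapAtom (ground (fstConst γ) (sndConst γ)) βh ≡ β
    κeq = mapAtom-const-injective (trans (mapAtom-∘ const (ground (fstConst γ) (sndConst γ)) βh)
            (trans (mapAtom-cong _ _ βh (λ y ym → sym (termsAt-const γ y (groundShapes-const tIn y ym)))) e))

groundAtoms : List ℕ → List ℕ → Data
groundAtoms Ps Is = concatMap (λ p → map (un p) Is ++ concatMap (λ a → map (bin p a) Is) Is) Ps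

∈groundAtoms : ∀ Ps Is (β : Atom ℕ) → predSym β ∈ Ps → All (_∈ Is) (termsOf β) → β ∈ groundAtoms Ps Is
∈groundAtoms Ps Is (un p a) pm (am ∷ []) = ∈ₚ.∈-concatMap⁺ _ {xs = Ps} (Any.map (λ { refl → ∈ₚ.∈-++⁺ˡ (∈ₚ.∈-map⁺ (un p) am) }) pm)
∈groundAtoms Ps Is (bin p a b) pm (am ∷ bm ∷ []) = ∈ₚ.∈-concatMap⁺ _ {xs = Ps} (Any.map (λ { refl →
  ∈ₚ.∈-++⁺ʳ (map (un p) Is) (∈ₚ.∈-concatMap⁺ _ {xs = Is} (Any.map (λ { refl → ∈ₚ.∈-map⁺ (bin p a) bm }) am)) }) pm)

groundAtoms-args : ∀ Ps Is (β : Atom ℕ) → β ∈ groundAtoms Ps Is → All (_∈ Is) (termsOf β)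
groundAtoms-args Ps Is β m with find (∈ₚ.∈-concatMap⁻ _ {xs = Ps} m)
... | p , _ , m2 with ∈ₚ.∈-++⁻ (map (un p) Is) m2
...   | inj₁ m3 with ∈ₚ.∈-map⁻ (un p) m3
...     | a , am , refl = am ∷ []
groundAtoms-args Ps Is β m | p , _ , m2 | inj₂ m3 with find (∈ₚ.∈-concatMap⁻ _ {xs = Is} m3)
...     | a , am , m4 with ∈ₚ.∈-map⁻ (bin p a) m4
...       | b , bm , refl = am ∷ bm ∷ []

groundAtoms-pred : ∀ Ps Is (β : Atom ℕ) → β ∈ groundAtoms Ps Is → predSym β ∈ Ps
groundAtoms-pred Ps Is β β∈ = viaPred (find (∈ₚ.∈-concatMap⁻ _ {xs = Ps} β∈))
  where
  unaryOrBinary : ∀ p → β ∈ map (un p) Is ⊎ β ∈ concatMap (λ a → map (bin p a) Is) Is → predSym β ≡ p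
  unaryOrBinary p (inj₁ β∈un) with ∈ₚ.∈-map⁻ (un p) β∈un
  ... | a , _ , refl = refl
  unaryOrBinary p (inj₂ β∈bin) with find (∈ₚ.∈-concatMap⁻ _ {xs = Is} β∈bin)
  ... | a , _ , β∈binₐ with ∈ₚ.∈-map⁻ (bin p a) β∈binₐ
  ...   | b , _ , refl = refl
  viaPred : Σ ℕ (λ p → p ∈ Ps × β ∈ (map (un p) Is ++ concatMap (λ a → map (bin p a) Is) Is)) → predSym β ∈ Ps
  viaPred (p , p∈ , β∈p) = subst (_∈ Ps) (sym (unaryOrBinary p (∈ₚ.∈-++⁻ (map (un p) Is) β∈p))) p∈

predSym-step : (T : Ontology) {u t : Shape} → ShapeGraph.Step T u t → predSym t ∈ ontPreds T
predSym-step T {u} {t} s = ∈ₚ.∈-concatMap⁺ _ {xs = T} (Any.map (λ { {τ} (_ , t∈) → there (inHead τ t∈) }) s)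
  where
  inHead : ∀ τ → t ∈ map (mapAtom (varPos (body τ) u)) (head τ) → predSym t ∈ map predSym (head τ)
  inHead τ t∈ with ∈ₚ.∈-map⁻ (mapAtom (varPos (body τ) u)) t∈
  ... | h , h∈ , refl = subst (_∈ map predSym (head τ)) (sym (predSym-mapAtom _ h)) (∈ₚ.∈-map⁺ predSym h∈)

predSym-path : (T : Ontology) {g t : Shape} → ShapeGraph.Path T g t → predSym g ∈ ontPreds T → predSym t ∈ ontPreds T
predSym-path T ε g∈ = g∈
predSym-path T (s ◅ ss) _ = predSym-path T ss (predSym-step T s)

groundShapes-mapAtom : {V W : Set} (f : V → W) (α : Atom V) → groundShapes (mapAtom f α) ≡ groundShapes α
groundShapes-mapAtom f (un p v) = refl
groundShapes-mapAtom f (bin p v w) = refl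

module Completion (T : Ontology) (A : Data) where
  open import Data.List.Membership.DecPropositional (atom-≟ ℕ._≟_) using (_∈?_)
  open ShapeGraph T
  open Entailment T A

  witness? : ∀ g t β → Dec (Witness g t β)
  witness? g t β = map′ fromAny toAny
      (path? g t ×-dec Any.any? (λ z1 → Any.any? (λ z2 → grounds? z1 z2) (ind A)) (ind A))
    where
    Grounds : ℕ → ℕ → Set
    Grounds z1 z2 = mapAtom (ground z1 z2) g ∈ A × mapAtom (ground z1 z2) t ≡ β
    grounds? : ∀ z1 z2 → Dec (Grounds z1 z2)
    grounds? z1 z2 = (mapAtom (ground z1 z2) g ∈? A) ×-dec atom-≟ ℕ._≟_ (mapAtom (ground z1 z2) t) β
    fromAny : Path g t × Any (λ z1 → Any (Grounds z1) (ind A)) (ind A) → Witness g t β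
    fromAny (path , any₁) with find any₁
    ... | z1 , z1∈ , any₂ with find any₂
    ...   | z2 , z2∈ , grounds = path , z1 , z2 , z1∈ , z2∈ , grounds
    toAny : Witness g t β → Path g t × Any (λ z1 → Any (Grounds z1) (ind A)) (ind A)
    toAny (path , z1 , z2 , z1∈ , z2∈ , grounds) = path , lose z1∈ (lose z2∈ grounds)

  certified? : ∀ β → Dec (Certified β)
  certified? β = (β ∈? A) ⊎-dec Any.any? (λ P → Any.any? (λ g → Any.any? (λ t → witness? g t β) (groundShapes β)) (entryShapes P)) (ontPreds T)

  completion : Data
  completion = A ++ filter certified? (groundAtoms (ontPreds T) (ind A))

  certified-filter : ∀ {β} → β ∈ filter certified? (groundAtoms (ontPreds T) (ind A)) → Certified β
  certified-filter β∈ = proj₂ (∈ₚ.∈-filter⁻ certified? {xs = groundAtoms (ontPreds T) (ind A)} β∈)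

  filtered-candidate : ∀ {β} → β ∈ filter certified? (groundAtoms (ontPreds T) (ind A)) → β ∈ groundAtoms (ontPreds T) (ind A)
  filtered-candidate β∈ = proj₁ (∈ₚ.∈-filter⁻ certified? {xs = groundAtoms (ontPreds T) (ind A)} β∈)

  completion-sound : ∀ β → β ∈ completion → Entails T A β
  completion-sound β β∈ = certified-sound β ([ inj₁ , certified-filter {β} ]′ (∈ₚ.∈-++⁻ A β∈))

  ground-args : ∀ {z1 z2} (t : Shape) → z1 ∈ ind A → z2 ∈ ind A → All (_∈ ind A) (termsOf (mapAtom (ground z1 z2) t))
  ground-args {z1} {z2} t z1∈ z2∈ =
    subst (All (_∈ ind A)) (sym (termsOf-mapAtom (ground z1 z2) t)) (Allₚ.map⁺ (All.tabulate λ {i} _ → ground∈ i))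
    where
    ground∈ : ∀ i → ground z1 z2 i ∈ ind A
    ground∈ c₁ = z1∈
    ground∈ c₂ = z2∈
    ground∈ c∗ = z1∈

  predSym-entryShape : ∀ {P g} → g ∈ entryShapes P → predSym g ≡ P
  predSym-entryShape (here refl) = refl
  predSym-entryShape (there (here refl)) = refl
  predSym-entryShape (there (there (here refl))) = refl

  witness-range : ∀ P g t β → P ∈ ontPreds T → g ∈ entryShapes P → Witness g t β → predSym β ∈ ontPreds T × All (_∈ ind A) (termsOf β)
  witness-range P g t .(mapAtom (ground z1 z2) t) P∈ g∈ (path , z1 , z2 , z1∈ , z2∈ , _ , refl) =
    subst (_∈ ontPreds T) (sym (predSym-mapAtom (ground z1 z2) t)) (predSym-path T path (subst (_∈ ontPreds T) (sym (predSym-entryShape g∈)) P∈)) ,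
    ground-args t z1∈ z2∈

  witnessed-range : ∀ β → Witnessed β → predSym β ∈ ontPreds T × All (_∈ ind A) (termsOf β)
  witnessed-range β w with find w
  ... | P , Pm , w2 with find w2
  ...   | g , gm , w3 with Any.satisfied w3
  ...     | t , wt = witness-range P g t β Pm gm wt

  completion-complete : ∀ β → Entails T A β → β ∈ completion
  completion-complete β e = [ ∈ₚ.∈-++⁺ˡ , (λ w → ∈ₚ.∈-++⁺ʳ A (∈ₚ.∈-filter⁺ certified? (candidate w) (inj₂ w))) ]′ (entailed⇒certified β e)
    where
    candidate : Witnessed β → β ∈ groundAtoms (ontPreds T) (ind A)
    candidate w = ∈groundAtoms (ontPreds T) (ind A) β (proj₁ (witnessed-range β w)) (proj₂ (witnessed-range β w))

  ind-completion⁻ : ∀ {x} → x ∈ ind completion → x ∈ ind A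
  ind-completion⁻ {x} x∈ = viaAtom (find (∈ₚ.∈-concatMap⁻ termsOf {xs = completion} x∈))
    where
    viaAtom : Σ (Atom ℕ) (λ β → β ∈ completion × x ∈ termsOf β) → x ∈ ind A
    viaAtom (β , β∈ , x∈β) = [ (λ β∈A → ∈ind β∈A x∈β) ,
      (λ β∈F → All.lookup (groundAtoms-args (ontPreds T) (ind A) β (filtered-candidate {β} β∈F)) x∈β) ]′
      (∈ₚ.∈-++⁻ A β∈)

  ind-completion⁺ : ∀ {x} → x ∈ ind A → x ∈ ind completion
  ind-completion⁺ {x} m with find (∈ₚ.∈-concatMap⁻ termsOf {xs = A} m)
  ... | β , βm , xm = ∈ₚ.∈-concatMap⁺ termsOf (lose (∈ₚ.∈-++⁺ˡ βm) xm)

  completion-model : (I : Interp) (ι : ℕ → Dom I) → ModelT I T → ModelA I ι A → ModelA I ι completion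
  completion-model I ι mT mA = All.tabulate λ {β} m → completion-sound β m I ι mT mA

  completion-Complete : Complete T completion
  completion-Complete α _ e = completion-complete α λ I ι mT mA → e I ι mT (completion-model I ι mT mA)

  entailsQ-from-completion : ∀ {n} (q : CQ n) a → EntailsQ T completion q a → EntailsQ T A q a
  entailsQ-from-completion q a e I ι mT mA = e I ι mT (completion-model I ι mT mA)

  entailsQ-to-completion : ∀ {n} (q : CQ n) a → EntailsQ T A q a → EntailsQ T completion q a
  entailsQ-to-completion q a e I ι mT mA = e I ι mT (All.tabulate λ m → All.lookup mA (∈ₚ.∈-++⁺ˡ m))

  ∈completion⇔certified : ∀ β → (β ∈ completion → Certified β) × (Certified β → β ∈ completion)
  ∈completion⇔certified β = (λ m → entailed⇒certified β (completion-sound β m)) , (λ e → completion-complete β (certified-sound β e))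

substAtoms : (∀ {n} → Atom (Fin n) → Fm n) → ∀ {n} → Fm n → Fm n
substAtoms f (atom α) = f α
substAtoms f (eq i j) = eq i j
substAtoms f tt = tt
substAtoms f ff = ff
substAtoms f (neg φ) = neg (substAtoms f φ)
substAtoms f (and φ ψ) = and (substAtoms f φ) (substAtoms f ψ)
substAtoms f (or φ ψ) = or (substAtoms f φ) (substAtoms f ψ)
substAtoms f (ex φ) = ex (substAtoms f φ)
substAtoms f (all φ) = all (substAtoms f φ)

module _ (f : ∀ {n} → Atom (Fin n) → Fm n) where

  substAtoms-PE : (∀ {n} (α : Atom (Fin n)) → IsPE (f α)) → ∀ {n} {φ : Fm n} → IsPE φ → IsPE (substAtoms f φ)
  substAtoms-PE f-PE (atom α) = f-PE α
  substAtoms-PE f-PE (eq i j) = eq i j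
  substAtoms-PE f-PE tt = tt
  substAtoms-PE f-PE ff = ff
  substAtoms-PE f-PE (and φ ψ) = and (substAtoms-PE f-PE φ) (substAtoms-PE f-PE ψ)
  substAtoms-PE f-PE (or φ ψ) = or (substAtoms-PE f-PE φ) (substAtoms-PE f-PE ψ)
  substAtoms-PE f-PE (ex φ) = ex (substAtoms-PE f-PE φ)

  fmSize-substAtoms : ∀ K → 1 ≤ K → (∀ {n} (α : Atom (Fin n)) → fmSize (f α) ≤ K) → ∀ {n} (φ : Fm n) → fmSize (substAtoms f φ) ≤ fmSize φ * K
  fmSize-substAtoms K 1≤K f≤K = go
    where
    open ℕₚ.≤-Reasoning
    go : ∀ {n} (φ : Fm n) → fmSize (substAtoms f φ) ≤ fmSize φ * K
    binary : ∀ {n} (φ ψ : Fm n) → suc (fmSize (substAtoms f φ) + fmSize (substAtoms f ψ)) ≤ suc (fmSize φ + fmSize ψ) * K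
    binary φ ψ = begin
      suc (fmSize (substAtoms f φ) + fmSize (substAtoms f ψ)) ≤⟨ ℕₚ.+-mono-≤ 1≤K (ℕₚ.+-mono-≤ (go φ) (go ψ)) ⟩
      K + (fmSize φ * K + fmSize ψ * K)                    ≡⟨ cong (K +_) (sym (ℕₚ.*-distribʳ-+ K (fmSize φ) (fmSize ψ))) ⟩
      suc (fmSize φ + fmSize ψ) * K                        ∎
    go (atom α) = ℕₚ.≤-trans (f≤K α) (ℕₚ.m≤m+n K _)
    go (eq i j) = ℕₚ.*-monoʳ-≤ 3 1≤K
    go tt = ℕₚ.*-monoʳ-≤ 1 1≤K
    go ff = ℕₚ.*-monoʳ-≤ 1 1≤K
    go (neg φ) = ℕₚ.+-mono-≤ 1≤K (go φ)
    go (and φ ψ) = binary φ ψ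
    go (or φ ψ) = binary φ ψ
    go (ex φ) = ℕₚ.+-mono-≤ 1≤K (ℕₚ.+-mono-≤ 1≤K (go φ))
    go (all φ) = ℕₚ.+-mono-≤ 1≤K (ℕₚ.+-mono-≤ 1≤K (go φ))

  Sat-substAtoms : (A B : Data) → (∀ {c} → c ∈ ind A ⇔ c ∈ ind B) →
    (∀ {n} (ρ : Tuple n) (α : Atom (Fin n)) → Sat A ρ (f α) ⇔ Sat B ρ (atom α)) →
    ∀ {n} (φ : Fm n) (ρ : Tuple n) → Sat A ρ (substAtoms f φ) ⇔ Sat B ρ φ
  Sat-substAtoms A B ind⇔ atom⇔ = go
    where
    go : ∀ {n} (φ : Fm n) (ρ : Tuple n) → Sat A ρ (substAtoms f φ) ⇔ Sat B ρ φ
    go (atom α) ρ = atom⇔ ρ α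
    go (eq i j) ρ = mk⇔ (λ e → e) (λ e → e)
    go tt ρ = mk⇔ (λ e → e) (λ e → e)
    go ff ρ = mk⇔ (λ e → e) (λ e → e)
    go (neg φ) ρ = ¬-cong-⇔ (go φ ρ)
    go (and φ ψ) ρ = go φ ρ ×-⇔ go ψ ρ
    go (or φ ψ) ρ = go φ ρ ⊎-⇔ go ψ ρ
    go (ex φ) ρ = mk⇔ (λ { (c , c∈ , s) → c , to ind⇔ c∈ , to (go φ (c VF.∷ ρ)) s })
                      (λ { (c , c∈ , s) → c , from ind⇔ c∈ , from (go φ (c VF.∷ ρ)) s })
    go (all φ) ρ = mk⇔ (λ s c c∈ → to (go φ (c VF.∷ ρ)) (s c (from ind⇔ c∈)))
                       (λ s c c∈ → from (go φ (c VF.∷ ρ)) (s c (to ind⇔ c∈)))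

⋁ : ∀ {n} → List (Fm n) → Fm n
⋁ [] = ff
⋁ (φ ∷ φs) = or φ (⋁ φs)

guard : {R : Set} → Dec R → ∀ {n} → Fm n → Fm n
guard (yes _) φ = φ
guard (no _) φ = ff

module _ (A : Data) {n : ℕ} (ρ : Tuple n) where

  Sat-⋁-map⁻ : {X : Set} (f : X → Fm n) (xs : List X) → Sat A ρ (⋁ (map f xs)) → Any (λ x → Sat A ρ (f x)) xs
  Sat-⋁-map⁻ f (x ∷ xs) (inj₁ s) = here s
  Sat-⋁-map⁻ f (x ∷ xs) (inj₂ s) = there (Sat-⋁-map⁻ f xs s)

  Sat-⋁-map⁺ : {X : Set} (f : X → Fm n) (xs : List X) → Any (λ x → Sat A ρ (f x)) xs → Sat A ρ (⋁ (map f xs))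
  Sat-⋁-map⁺ f (x ∷ xs) (here s) = inj₁ s
  Sat-⋁-map⁺ f (x ∷ xs) (there s) = inj₂ (Sat-⋁-map⁺ f xs s)

  Sat-guard⁻ : {R : Set} (d : Dec R) (φ : Fm n) → Sat A ρ (guard d φ) → R × Sat A ρ φ
  Sat-guard⁻ (yes r) φ s = r , s

  Sat-guard⁺ : {R : Set} (d : Dec R) (φ : Fm n) → R → Sat A ρ φ → Sat A ρ (guard d φ)
  Sat-guard⁺ (yes _) φ _ s = s
  Sat-guard⁺ (no ¬r) φ r s = ¬r r

⋁-map-PE : ∀ {n} {X : Set} (f : X → Fm n) xs → (∀ x → IsPE (f x)) → IsPE (⋁ (map f xs))
⋁-map-PE f [] f-PE = ff
⋁-map-PE f (x ∷ xs) f-PE = or (f-PE x) (⋁-map-PE f xs f-PE)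

guard-PE : ∀ {n} {R : Set} (d : Dec R) {φ : Fm n} → IsPE φ → IsPE (guard d φ)
guard-PE (yes _) φ-PE = φ-PE
guard-PE (no _) φ-PE = ff

1≤fmSize : ∀ {n} (φ : Fm n) → 1 ≤ fmSize φ
1≤fmSize (atom (un p v)) = s≤s z≤n
1≤fmSize (atom (bin p v w)) = s≤s z≤n
1≤fmSize (eq i j) = s≤s z≤n
1≤fmSize tt = s≤s z≤n
1≤fmSize ff = s≤s z≤n
1≤fmSize (neg φ) = s≤s z≤n
1≤fmSize (and φ ψ) = s≤s z≤n
1≤fmSize (or φ ψ) = s≤s z≤n
1≤fmSize (ex φ) = s≤s z≤n
1≤fmSize (all φ) = s≤s z≤n

fmSize-guard : ∀ {n} {R : Set} (d : Dec R) (φ : Fm n) → fmSize (guard d φ) ≤ fmSize φ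
fmSize-guard (yes _) φ = ℕₚ.≤-refl
fmSize-guard (no _) φ = 1≤fmSize φ

fmSize-⋁-map : ∀ {n} {X : Set} (f : X → Fm n) (xs : List X) K → (∀ x → fmSize (f x) ≤ K) →
  fmSize (⋁ (map f xs)) ≤ length xs * suc K + 1
fmSize-⋁-map f [] K f≤K = ℕₚ.≤-refl
fmSize-⋁-map f (x ∷ xs) K f≤K =
  s≤s (ℕₚ.≤-trans (ℕₚ.+-mono-≤ (f≤K x) (fmSize-⋁-map f xs K f≤K)) (ℕₚ.≤-reflexive (sym (ℕₚ.+-assoc K (length xs * suc K) 1))))

atomSize≤3 : {V : Set} (α : Atom V) → atomSize α ≤ 3
atomSize≤3 (un p v) = from-yes (2 ℕ.≤? 3)
atomSize≤3 (bin p v w) = ℕₚ.≤-refl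

length-groundShapes : {V : Set} (α : Atom V) → length (groundShapes α) ≤ 4
length-groundShapes (un p v) = from-yes (2 ℕ.≤? 4)
length-groundShapes (bin p v w) = ℕₚ.≤-refl

length-ontPreds : (T : Ontology) → length (ontPreds T) ≡ ontSize T
length-ontPreds [] = refl
length-ontPreds (τ ∷ T) = trans (Listₚ.length-++ (predSym (body τ) ∷ map predSym (head τ)))
  (cong₂ _+_ (cong suc (Listₚ.length-map predSym (head τ))) (length-ontPreds T))

-- The witness formula lives under two new binders z2 (index 0) and z1 (index 1);
-- c∗ is sent to z1 as in ground.
posVar : ∀ {n} → Fin 3 → Fin (suc (suc n))
posVar c₁ = suc zero
posVar c₂ = zero
posVar c∗ = suc zero

posVar-ground : ∀ {n} (ρ : Tuple n) z1 z2 (i : Fin 3) → (z2 VF.∷ z1 VF.∷ ρ) (posVar i) ≡ ground z1 z2 i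
posVar-ground ρ z1 z2 c₁ = refl
posVar-ground ρ z1 z2 c₂ = refl
posVar-ground ρ z1 z2 c∗ = refl

argsEq : ∀ {n} → Shape → Atom (Fin n) → Fm (suc (suc n))
argsEq (un _ i) (un _ v) = eq (posVar i) (suc (suc v))
argsEq (bin _ i j) (bin _ v w) = and (eq (posVar i) (suc (suc v))) (eq (posVar j) (suc (suc w)))
argsEq (un _ _) (bin _ _ _) = ff
argsEq (bin _ _ _) (un _ _) = ff

argsEq-PE : ∀ {n} (t : Shape) (α : Atom (Fin n)) → IsPE (argsEq t α)
argsEq-PE (un _ i) (un _ v) = eq _ _
argsEq-PE (bin _ i j) (bin _ v w) = and (eq _ _) (eq _ _)
argsEq-PE (un _ _) (bin _ _ _) = ff
argsEq-PE (bin _ _ _) (un _ _) = ff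

fmSize-argsEq : ∀ {n} (t : Shape) (α : Atom (Fin n)) → fmSize (argsEq t α) ≤ 7
fmSize-argsEq (un _ i) (un _ v) = from-yes (3 ℕ.≤? 7)
fmSize-argsEq (bin _ i j) (bin _ v w) = ℕₚ.≤-refl
fmSize-argsEq (un _ _) (bin _ _ _) = from-yes (1 ℕ.≤? 7)
fmSize-argsEq (bin _ _ _) (un _ _) = from-yes (1 ℕ.≤? 7)

module _ (A : Data) {n : ℕ} (ρ : Tuple n) (z1 z2 : ℕ) where

  Sat-argsEq⁻ : (t : Shape) (α : Atom (Fin n)) → t ∈ groundShapes α →
    Sat A (z2 VF.∷ z1 VF.∷ ρ) (argsEq t α) → mapAtom (ground z1 z2) t ≡ mapAtom ρ α
  Sat-argsEq⁻ _ (un p v) (here refl) e = cong (un p) e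
  Sat-argsEq⁻ _ (un p v) (there (here refl)) e = cong (un p) e
  Sat-argsEq⁻ _ (bin p v w) (here refl) (e₁ , e₂) = cong₂ (bin p) e₁ e₂
  Sat-argsEq⁻ _ (bin p v w) (there (here refl)) (e₁ , e₂) = cong₂ (bin p) e₁ e₂
  Sat-argsEq⁻ _ (bin p v w) (there (there (here refl))) (e₁ , e₂) = cong₂ (bin p) e₁ e₂
  Sat-argsEq⁻ _ (bin p v w) (there (there (there (here refl)))) (e₁ , e₂) = cong₂ (bin p) e₁ e₂

  Sat-argsEq⁺ : (t : Shape) (α : Atom (Fin n)) →
    mapAtom (ground z1 z2) t ≡ mapAtom ρ α → Sat A (z2 VF.∷ z1 VF.∷ ρ) (argsEq t α)
  Sat-argsEq⁺ (un _ i) (un p v) e = trans (posVar-ground ρ z1 z2 i) (proj₂ (un-injective e))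
  Sat-argsEq⁺ (bin _ i j) (bin p v w) e =
    trans (posVar-ground ρ z1 z2 i) (proj₁ (proj₂ (bin-injective e))) , trans (posVar-ground ρ z1 z2 j) (proj₂ (proj₂ (bin-injective e)))
  Sat-argsEq⁺ (un _ _) (bin _ _ _) ()
  Sat-argsEq⁺ (bin _ _ _) (un _ _) ()

Any-mapWith∈ : {X : Set} {P Q : X → Set} {xs : List X} → (∀ {x} → x ∈ xs → P x → Q x) → Any P xs → Any Q xs
Any-mapWith∈ f pxs with find pxs
... | x , x∈ , px = lose x∈ (f x∈ px)

module ExpandFO (T : Ontology) where
  open ShapeGraph T

  witnessFm : ∀ {n} → Shape → Shape → Atom (Fin n) → Fm n
  witnessFm g t α = guard (path? g t) (ex (ex (and (atom (mapAtom posVar g)) (argsEq t α))))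

  viaEntry : ∀ {n} → Shape → Atom (Fin n) → Fm n
  viaEntry g α = ⋁ (map (λ t → witnessFm g t α) (groundShapes α))

  viaPred : ∀ {n} → ℕ → Atom (Fin n) → Fm n
  viaPred P α = ⋁ (map (λ g → viaEntry g α) (entryShapes P))

  viaOntology : ∀ {n} → Atom (Fin n) → Fm n
  viaOntology α = ⋁ (map (λ P → viaPred P α) (ontPreds T))

  completedAtomFm : ∀ {n} → Atom (Fin n) → Fm n
  completedAtomFm α = or (atom α) (viaOntology α)

  expand : ∀ {n} → Fm n → Fm n
  expand = substAtoms completedAtomFm

  completedAtomFm-PE : ∀ {n} (α : Atom (Fin n)) → IsPE (completedAtomFm α)
  completedAtomFm-PE α = or (atom α) (⋁-map-PE _ (ontPreds T) λ P → ⋁-map-PE _ (entryShapes P) λ g →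
    ⋁-map-PE _ (groundShapes α) λ t → guard-PE (path? g t) (ex (ex (and (atom (mapAtom posVar g)) (argsEq-PE t α)))))

  fmSize-witnessFm : ∀ {n} g t (α : Atom (Fin n)) → fmSize (witnessFm g t α) ≤ 15
  fmSize-witnessFm g t α = ℕₚ.≤-trans (fmSize-guard (path? g t) _)
    (ℕₚ.+-monoʳ-≤ 5 (ℕₚ.+-mono-≤ (atomSize≤3 (mapAtom posVar g)) (fmSize-argsEq t α)))

  fmSize-completedAtomFm : ∀ {n} (α : Atom (Fin n)) → fmSize (completedAtomFm α) ≤ 200 * suc (ontSize T)
  fmSize-completedAtomFm α = begin
    fmSize (completedAtomFm α)                   ≤⟨ s≤s (ℕₚ.+-mono-≤ (atomSize≤3 α) (fmSize-⋁-map (λ P → viaPred P α) (ontPreds T) 199 perPred)) ⟩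
    suc (3 + (length (ontPreds T) * 200 + 1))   ≡⟨ cong (λ k → 4 + (k * 200 + 1)) (length-ontPreds T) ⟩
    4 + (ontSize T * 200 + 1)                    ≡⟨ cong (4 +_) (ℕₚ.+-comm (ontSize T * 200) 1) ⟩
    5 + ontSize T * 200                          ≤⟨ ℕₚ.+-monoˡ-≤ _ (from-yes (5 ℕ.≤? 200)) ⟩
    200 + ontSize T * 200                        ≡⟨ cong (200 +_) (ℕₚ.*-comm (ontSize T) 200) ⟩
    200 + 200 * ontSize T                        ≡⟨ ℕₚ.*-suc 200 (ontSize T) ⟨
    200 * suc (ontSize T)                        ∎
    where
    open ℕₚ.≤-Reasoning
    perEntry : ∀ g → fmSize (viaEntry g α) ≤ 65
    perEntry g = ℕₚ.≤-trans (fmSize-⋁-map (λ t → witnessFm g t α) (groundShapes α) 15 (λ t → fmSize-witnessFm g t α))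
      (ℕₚ.+-monoˡ-≤ 1 (ℕₚ.*-monoˡ-≤ 16 (length-groundShapes α)))
    perPred : ∀ P → fmSize (viaPred P α) ≤ 199
    perPred P = fmSize-⋁-map (λ g → viaEntry g α) (entryShapes P) 65 perEntry

  fmSize-expand : ∀ {n} (φ : Fm n) → fmSize (expand φ) ≤ 200 * (fmSize φ * suc (ontSize T))
  fmSize-expand φ = ℕₚ.≤-trans (fmSize-substAtoms completedAtomFm _ (s≤s z≤n) fmSize-completedAtomFm φ)
    (ℕₚ.≤-reflexive (reassoc (fmSize φ) (ontSize T)))
    where
    reassoc : ∀ m t → m * (200 * suc t) ≡ 200 * (m * suc t)
    reassoc = solve-∀

  module _ (A : Data) where
    open Entailment T A
    open Completion T A

    Sat-witnessFm⁻ : ∀ {n} (ρ : Tuple n) g t α → t ∈ groundShapes α → Sat A ρ (witnessFm g t α) → Witness g t (mapAtom ρ α)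
    Sat-witnessFm⁻ ρ g t α t∈ s with Sat-guard⁻ A ρ (path? g t) _ s
    ... | path , (z1 , z1∈ , z2 , z2∈ , g∈ , args) = path , z1 , z2 , z1∈ , z2∈ ,
          subst (_∈ A) (trans (mapAtom-∘ _ posVar g) (mapAtom-cong _ _ g λ i _ → posVar-ground ρ z1 z2 i)) g∈ ,
          Sat-argsEq⁻ A ρ z1 z2 t α t∈ args

    Sat-witnessFm⁺ : ∀ {n} (ρ : Tuple n) g t α → Witness g t (mapAtom ρ α) → Sat A ρ (witnessFm g t α)
    Sat-witnessFm⁺ ρ g t α (path , z1 , z2 , z1∈ , z2∈ , g∈ , same) = Sat-guard⁺ A ρ (path? g t) _ path
      (z1 , z1∈ , z2 , z2∈ , subst (_∈ A) (sym (trans (mapAtom-∘ _ posVar g) (mapAtom-cong _ _ g λ i _ → posVar-ground ρ z1 z2 i))) g∈ ,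
       Sat-argsEq⁺ A ρ z1 z2 t α same)

    Sat-completedAtomFm⇔ : ∀ {n} (ρ : Tuple n) α → Sat A ρ (completedAtomFm α) ⇔ Certified (mapAtom ρ α)
    Sat-completedAtomFm⇔ ρ α = mk⇔ (λ { (inj₁ α∈) → inj₁ α∈ ; (inj₂ s) → inj₂ (Sat⇒Witnessed s) })
                                   (λ { (inj₁ α∈) → inj₁ α∈ ; (inj₂ w) → inj₂ (Witnessed⇒Sat w) })
      where
      WitnessedVia : Shape → Set
      WitnessedVia g = Any (λ t → Witness g t (mapAtom ρ α)) (groundShapes (mapAtom ρ α))
      fromEntry : ∀ g → Sat A ρ (viaEntry g α) → WitnessedVia g
      fromEntry g s = subst (Any _) (sym (groundShapes-mapAtom ρ α))
        (Any-mapWith∈ (λ t∈ → Sat-witnessFm⁻ ρ g _ α t∈) (Sat-⋁-map⁻ A ρ (λ t → witnessFm g t α) (groundShapes α) s))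
      fromPred : ∀ P → Sat A ρ (viaPred P α) → Any WitnessedVia (entryShapes P)
      fromPred P s = Any.map (λ {g} → fromEntry g) (Sat-⋁-map⁻ A ρ (λ g → viaEntry g α) (entryShapes P) s)
      Sat⇒Witnessed : Sat A ρ (viaOntology α) → Witnessed (mapAtom ρ α)
      Sat⇒Witnessed s = Any.map (λ {P} → fromPred P) (Sat-⋁-map⁻ A ρ (λ P → viaPred P α) (ontPreds T) s)
      toEntry : ∀ g → WitnessedVia g → Sat A ρ (viaEntry g α)
      toEntry g w = Sat-⋁-map⁺ A ρ (λ t → witnessFm g t α) (groundShapes α)
        (Any.map (Sat-witnessFm⁺ ρ g _ α) (subst (Any _) (groundShapes-mapAtom ρ α) w))
      toPred : ∀ P → Any WitnessedVia (entryShapes P) → Sat A ρ (viaPred P α)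
      toPred P w = Sat-⋁-map⁺ A ρ (λ g → viaEntry g α) (entryShapes P) (Any.map (λ {g} → toEntry g) w)
      Witnessed⇒Sat : Witnessed (mapAtom ρ α) → Sat A ρ (viaOntology α)
      Witnessed⇒Sat w = Sat-⋁-map⁺ A ρ (λ P → viaPred P α) (ontPreds T) (Any.map (λ {P} → toPred P) w)

    Sat-expand : ∀ {n} (φ : Fm n) (ρ : Tuple n) → Sat A ρ (expand φ) ⇔ Sat completion ρ φ
    Sat-expand = Sat-substAtoms completedAtomFm A completion (mk⇔ ind-completion⁺ ind-completion⁻)
      (λ ρ α → mk⇔ (λ s → proj₂ (∈completion⇔certified _) (to (Sat-completedAtomFm⇔ ρ α) s))
                   (λ α∈ → from (Sat-completedAtomFm⇔ ρ α) (proj₁ (∈completion⇔certified _) α∈)))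

module _ {n : ℕ} (q : CQ n) (T : Ontology) where

  FORewArbitrary-viaCompletion : (φ ψ : Fm n) → FORewComplete q T φ →
    (∀ A (a : Tuple n) → Sat A a ψ ⇔ Sat (Completion.completion T A) a φ) → FORewArbitrary q T ψ
  FORewArbitrary-viaCompletion φ ψ rewφ ψ⇔φ A a a⊆A =
      (λ e → from (ψ⇔φ A a) (proj₁ onCompletion (entailsQ-to-completion q a e)))
    , (λ s → entailsQ-from-completion q a (proj₂ onCompletion (to (ψ⇔φ A a) s)))
    where
    open Completion T A
    onCompletion : (EntailsQ T completion q a → Sat completion a φ) × (Sat completion a φ → EntailsQ T completion q a)
    onCompletion = rewφ completion completion-Complete a (λ i → ind-completion⁺ (a⊆A i))

  expand-FORewArbitrary : (φ : Fm n) → FORewComplete q T φ → FORewArbitrary q T (ExpandFO.expand T φ)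
  expand-FORewArbitrary φ rewφ = FORewArbitrary-viaCompletion φ _ rewφ (λ A a → ExpandFO.Sat-expand T A φ a)

idbNames : ∀ {k} → List (BodyAtom k) → List ℕ
idbNames [] = []
idbNames (edb _ ∷ bs) = idbNames bs
idbNames (idb p _ ∷ bs) = p ∷ idbNames bs
idbNames (eqb _ _ ∷ bs) = idbNames bs

idbNames-∈ : ∀ {k} {p} {xs : List (Fin k)} (bs : List (BodyAtom k)) → idb p xs ∈ bs → p ∈ idbNames bs
idbNames-∈ (edb _ ∷ bs) (there m) = idbNames-∈ bs m
idbNames-∈ (idb q _ ∷ bs) (here refl) = here refl
idbNames-∈ (idb q _ ∷ bs) (there m) = there (idbNames-∈ bs m)
idbNames-∈ (eqb _ _ ∷ bs) (there m) = idbNames-∈ bs m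

ruleIdbNames : Rule → List ℕ
ruleIdbNames r = headPred r ∷ idbNames (bodyAtoms r)

nodesOf : ℕ → List Shape
nodesOf P = un P c₁ ∷ un P c₂ ∷ bin P c₁ c₁ ∷ bin P c₁ c₂ ∷ bin P c₁ c∗ ∷ bin P c₂ c₁ ∷ bin P c₂ c₂
           ∷ bin P c₂ c∗ ∷ bin P c∗ c₁ ∷ bin P c∗ c₂ ∷ []

bodyShape∈nodesOf : (b : Atom (Fin 2)) {u : Shape} → u ∈ bodyShapes b → u ∈ nodesOf (predSym b)
bodyShape∈nodesOf (un p v) (here refl) = here refl
bodyShape∈nodesOf (un p v) (there (here refl)) = there (here refl)
bodyShape∈nodesOf (bin p v w) m with v Fin.≟ w
bodyShape∈nodesOf (bin p v w) (here refl) | yes _ = there (there (here refl))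
bodyShape∈nodesOf (bin p v w) (there (here refl)) | yes _ = there (there (there (there (there (there (here refl))))))
bodyShape∈nodesOf (bin p v w) (here refl) | no _ = there (there (here refl))
bodyShape∈nodesOf (bin p v w) (there (here refl)) | no _ = there (there (there (here refl)))
bodyShape∈nodesOf (bin p v w) (there (there (here refl))) | no _ = there (there (there (there (here refl))))
bodyShape∈nodesOf (bin p v w) (there (there (there (here refl)))) | no _ = there (there (there (there (there (here refl)))))
bodyShape∈nodesOf (bin p v w) (there (there (there (there (here refl))))) | no _ = there (there (there (there (there (there (here refl))))))
bodyShape∈nodesOf (bin p v w) (there (there (there (there (there (here refl)))))) | no _ = there (there (there (there (there (there (there (here refl)))))))
bodyShape∈nodesOf (bin p v w) (there (there (there (there (there (there (here refl))))))) | no _ = there (there (there (there (there (there (there (there (here refl))))))))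
bodyShape∈nodesOf (bin p v w) (there (there (there (there (there (there (there (here refl)))))))) | no _ = there (there (there (there (there (there (there (there (there (here refl)))))))))

groundShape∈nodesOf : {V : Set} (β : Atom V) {t : Shape} → t ∈ groundShapes β → t ∈ nodesOf (predSym β)
groundShape∈nodesOf (un p _) (here refl) = here refl
groundShape∈nodesOf (un p _) (there (here refl)) = there (here refl)
groundShape∈nodesOf (bin p _ _) (here refl) = there (there (here refl))
groundShape∈nodesOf (bin p _ _) (there (here refl)) = there (there (there (here refl)))
groundShape∈nodesOf (bin p _ _) (there (there (here refl))) = there (there (there (there (there (here refl)))))
groundShape∈nodesOf (bin p _ _) (there (there (there (here refl)))) = there (there (there (there (there (there (here refl))))))

entryShape∈nodesOf : ∀ P {t : Shape} → t ∈ entryShapes P → t ∈ nodesOf P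
entryShape∈nodesOf P (here refl) = here refl
entryShape∈nodesOf P (there (here refl)) = there (there (here refl))
entryShape∈nodesOf P (there (there (here refl))) = there (there (there (here refl)))

entryVar : Fin 3 → Fin 2
entryVar c₁ = zero
entryVar c₂ = suc zero
entryVar c∗ = zero

v₀ v₁ : Fin 2
v₀ = zero
v₁ = suc zero

args₂ : ℕ → ℕ → Fin 2 → ℕ
args₂ a b zero = a
args₂ a b (suc zero) = b

listIf : {X : Set} → Dec X → Rule → List Rule
listIf (yes _) r = r ∷ []
listIf (no _) r = []

∈listIf : {X : Set} (d : Dec X) (r : Rule) → X → r ∈ listIf d r
∈listIf (yes _) r x = here refl
∈listIf (no nx) r x = ⊥-elim (nx x)

listIf⁻ : {X : Set} (d : Dec X) (r r' : Rule) → r' ∈ listIf d r → X × r' ≡ r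
listIf⁻ (yes x) r r' (here e) = x , e
listIf⁻ (no _) r r' ()

idb-injective : ∀ {k p q} {xs ys : List (Fin k)} → idb p xs ≡ idb q ys → p ≡ q
idb-injective refl = refl

progSize-++ : ∀ xs ys → progSize (xs ++ ys) ≡ progSize xs + progSize ys
progSize-++ xs ys = trans (cong sum (Listₚ.map-++ ruleSize xs ys)) (Sumₚ.sum-++ (map ruleSize xs) (map ruleSize ys))

progSize-concatMap : ∀ {X : Set} (f : X → Program) (xs : List X) → progSize (concatMap f xs) ≡ sum (map (λ x → progSize (f x)) xs)
progSize-concatMap f [] = refl
progSize-concatMap f (x ∷ xs) = trans (progSize-++ (f x) (concatMap f xs)) (cong (progSize (f x) +_) (progSize-concatMap f xs))

sum-map-≤ : ∀ {X : Set} (f : X → ℕ) (xs : List X) K → (∀ x → f x ≤ K) → sum (map f xs) ≤ length xs * K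
sum-map-≤ f [] K h = z≤n
sum-map-≤ f (x ∷ xs) K h = ℕₚ.+-mono-≤ (h x) (sum-map-≤ f xs K h)

sum-map-const : ∀ {X : Set} (xs : List X) K → sum (map (λ _ → K) xs) ≡ length xs * K
sum-map-const [] K = refl
sum-map-const (x ∷ xs) K = cong (K +_) (sum-map-const xs K)

sum-map-mono : ∀ {X : Set} (f h : X → ℕ) (xs : List X) → (∀ x → f x ≤ h x) → sum (map f xs) ≤ sum (map h xs)
sum-map-mono f h [] le = z≤n
sum-map-mono f h (x ∷ xs) le = ℕₚ.+-mono-≤ (le x) (sum-map-mono f h xs le)

sum-map-* : ∀ {X : Set} (f : X → ℕ) (xs : List X) K → sum (map (λ x → K * f x) xs) ≡ K * sum (map f xs)
sum-map-* f [] K = sym (ℕₚ.*-zeroʳ K)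
sum-map-* f (x ∷ xs) K = trans (cong (K * f x +_) (sum-map-* f xs K)) (sym (ℕₚ.*-distribˡ-+ K (f x) _))

length-bodyShapes : ∀ (b : Atom (Fin 2)) → length (bodyShapes b) ≤ 8
length-bodyShapes (un p v) = s≤s (s≤s z≤n)
length-bodyShapes (bin p v w) = go (v Fin.≟ w)
  where go : (d : Dec (v ≡ w)) → length (binShapes p d) ≤ 8
        go (yes _) = s≤s (s≤s z≤n)
        go (no _) = ℕₚ.≤-refl

-- Π′ runs Π on the completion of A, which it computes with new rules: one IDB
-- predicate per strongly connected class of the shape graph, derived for (z1, z2)
-- from a data atom of an entry shape and propagated along edges between distinct
-- classes (so the new rules are nonrecursive); exit rules turn derived ground
-- shapes into completed atoms S(a, b) under binPred S or unPred S, which replace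
-- the data atoms of Π whose predicate occurs in T.
module NDLConstruction (T : Ontology) (Π : Program) (g : ℕ) where
  open import Data.List.Membership.DecPropositional (atom-≟ (Fin._≟_ {n = 3})) using (_∈?_)
  open ShapeGraph T

  _~_ : Shape → Shape → Set
  u ~ v = Path u v × Path v u

  _~?_ : ∀ u v → Dec (u ~ v)
  u ~? v = path? u v ×-dec path? v u

  ~sym : ∀ {u v} → u ~ v → v ~ u
  ~sym (a , b) = b , a

  ~trans : ∀ {u v w} → u ~ v → v ~ w → u ~ w
  ~trans (a , b) (c , d) = a ◅◅ c , d ◅◅ b

  preds : List ℕ
  preds = ontPreds T

  nodes : List Shape
  nodes = concatMap nodesOf preds

  #nodes : ℕ
  #nodes = length nodes

  entries : List Shape
  entries = concatMap entryShapes preds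

  -- IDB names: those of Π and g lie below fresh, class names in
  -- [fresh, fresh + #nodes), and completed data predicates above (even/odd).
  fresh : ℕ
  fresh = suc (max g (concatMap ruleIdbNames Π))

  classIndex : Shape → ℕ
  classIndex t = firstIndex (λ w → w ~? t) nodes

  nodePred : Shape → ℕ
  nodePred t = fresh + classIndex t

  binPred unPred : ℕ → ℕ
  binPred S = fresh + #nodes + (2 * S)
  unPred S = fresh + #nodes + suc (2 * S)

  classIndex<#nodes : ∀ {t} → t ∈ nodes → classIndex t < #nodes
  classIndex<#nodes tm = firstIndex<length (λ w → w ~? _) nodes (lose tm (ε , ε))

  nodePred-~ : ∀ {u v} → u ~ v → nodePred u ≡ nodePred v
  nodePred-~ uv = cong (fresh +_) (firstIndex-cong (λ w → w ~? _) (λ w → w ~? _) (λ w wu → ~trans wu uv) (λ w wv → ~trans wv (~sym uv)) nodes)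

  nodePred-injective : ∀ {u v} → u ∈ nodes → nodePred u ≡ nodePred v → u ~ v
  nodePred-injective um e with firstIndex-≡⇒∃ (λ w → w ~? _) (λ w → w ~? _) nodes (ℕₚ.+-cancelˡ-≡ fresh _ _ e) (lose um (ε , ε))
  ... | w , wu , wv = ~trans (~sym wu) wv

  nodePred< : ∀ {t} → t ∈ nodes → nodePred t < fresh + #nodes
  nodePred< tm = ℕₚ.+-monoʳ-< fresh (classIndex<#nodes tm)

  ∈nodes : ∀ {P t} → P ∈ preds → t ∈ nodesOf P → t ∈ nodes
  ∈nodes Pm tm = ∈ₚ.∈-concatMap⁺ nodesOf (lose Pm tm)

  stepSource∈nodes′ : ∀ {u v} → Σ TGD (λ τ → τ ∈ T × TGDStep τ u v) → u ∈ nodes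
  stepSource∈nodes′ (τ , τm , (um , _)) = ∈nodes (∈ₚ.∈-concatMap⁺ _ {xs = T} (lose τm (here refl))) (bodyShape∈nodesOf (body τ) um)

  stepSource∈nodes : ∀ {u v} → Step u v → u ∈ nodes
  stepSource∈nodes s = stepSource∈nodes′ (find s)

  entry∈nodes′ : ∀ {gh} → Σ ℕ (λ P → P ∈ preds × gh ∈ entryShapes P) → gh ∈ nodes
  entry∈nodes′ (P , Pm , ghm) = ∈nodes Pm (entryShape∈nodesOf P ghm)

  entry∈nodes : ∀ {gh} → gh ∈ entries → gh ∈ nodes
  entry∈nodes m = entry∈nodes′ (find (∈ₚ.∈-concatMap⁻ entryShapes {xs = preds} m))

  entryRule : Shape → Rule
  entryRule gh = record { nvars = 2 ; headPred = nodePred gh ; headArgs = v₀ ∷ v₁ ∷ [] ; bodyAtoms = edb (mapAtom entryVar gh) ∷ [] }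

  edgeRule : Shape → Shape → Rule
  edgeRule s t = record { nvars = 2 ; headPred = nodePred t ; headArgs = v₀ ∷ v₁ ∷ [] ; bodyAtoms = idb (nodePred s) (v₀ ∷ v₁ ∷ []) ∷ [] }

  exitRule : ℕ → List (Fin 2) → Shape → List (Fin 2) → Rule
  exitRule h ha t ba = record { nvars = 2 ; headPred = h ; headArgs = ha ; bodyAtoms = idb (nodePred t) ba ∷ [] }

  exitRules : ℕ → List Rule
  exitRules S = exitRule (binPred S) (v₀ ∷ v₁ ∷ []) (bin S c₁ c₂) (v₀ ∷ v₁ ∷ [])
           ∷ exitRule (binPred S) (v₀ ∷ v₁ ∷ []) (bin S c₂ c₁) (v₁ ∷ v₀ ∷ [])
           ∷ exitRule (binPred S) (v₀ ∷ v₀ ∷ []) (bin S c₁ c₁) (v₀ ∷ v₁ ∷ [])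
           ∷ exitRule (binPred S) (v₀ ∷ v₀ ∷ []) (bin S c₂ c₂) (v₁ ∷ v₀ ∷ [])
           ∷ exitRule (unPred S) (v₀ ∷ []) (un S c₁) (v₀ ∷ v₁ ∷ [])
           ∷ exitRule (unPred S) (v₀ ∷ []) (un S c₂) (v₁ ∷ v₀ ∷ []) ∷ []

  edgeRuleIf : Shape → Shape → List Rule
  edgeRuleIf s t = listIf ((t ∈? nodes) ×-dec ¬? (s ~? t)) (edgeRule s t)

  edgeRulesOf : TGD → List Rule
  edgeRulesOf τ = concatMap (λ s → concatMap (λ h → edgeRuleIf s (mapAtom (varPos (body τ) s) h)) (head τ)) (bodyShapes (body τ))

  edgeRules : List Rule
  edgeRules = concatMap edgeRulesOf T

  entryRules : List Rule
  entryRules = concatMap (λ P → map entryRule (entryShapes P)) preds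

  allExitRules : List Rule
  allExitRules = concatMap exitRules preds

  redirectUn : ∀ {k} (S : ℕ) → Fin k → Dec (S ∈ preds) → BodyAtom k
  redirectUn S u (yes _) = idb (unPred S) (u ∷ [])
  redirectUn S u (no _) = edb (un S u)

  redirectBin : ∀ {k} (S : ℕ) → Fin k → Fin k → Dec (S ∈ preds) → BodyAtom k
  redirectBin S u w (yes _) = idb (binPred S) (u ∷ w ∷ [])
  redirectBin S u w (no _) = edb (bin S u w)

  redirectAtom : ∀ {k} → BodyAtom k → BodyAtom k
  redirectAtom (edb (un S u)) = redirectUn S u (S ∈ℕ.∈? preds)
  redirectAtom (edb (bin S u w)) = redirectBin S u w (S ∈ℕ.∈? preds)
  redirectAtom (idb p xs) = idb p xs
  redirectAtom (eqb i j) = eqb i j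

  redirect : Rule → Rule
  redirect r = record { nvars = nvars r ; headPred = headPred r ; headArgs = headArgs r ; bodyAtoms = map redirectAtom (bodyAtoms r) }

  Π′ : Program
  Π′ = map redirect Π ++ ((entryRules ++ edgeRules) ++ allExitRules)

  data RuleOrigin (r : Rule) : Set where
    fromΠ : ∀ r0 → r0 ∈ Π → r ≡ redirect r0 → RuleOrigin r
    fromEntry : ∀ gh → gh ∈ entries → r ≡ entryRule gh → RuleOrigin r
    fromEdge : ∀ s t → Step s t → t ∈ nodes → ¬ s ~ t → r ≡ edgeRule s t → RuleOrigin r
    fromExit : ∀ S → S ∈ preds → r ∈ exitRules S → RuleOrigin r

  private
    originEntry : ∀ {r} → Σ ℕ (λ P → P ∈ preds × r ∈ map entryRule (entryShapes P)) → RuleOrigin r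
    originEntry {r} (P , P∈ , r∈) = byShape (∈ₚ.∈-map⁻ entryRule r∈)
      where
      byShape : Σ Shape (λ gh → gh ∈ entryShapes P × r ≡ entryRule gh) → RuleOrigin r
      byShape (gh , gh∈ , r≡) = fromEntry gh (∈ₚ.∈-concatMap⁺ entryShapes (lose P∈ gh∈)) r≡

    originHead : ∀ {r} τ → τ ∈ T → ∀ s → s ∈ bodyShapes (body τ) →
      Σ (Atom (Fin 2)) (λ h → h ∈ head τ × r ∈ edgeRuleIf s (mapAtom (varPos (body τ) s) h)) → RuleOrigin r
    originHead {r} τ τ∈ s s∈ (h , h∈ , r∈) = byRule (listIf⁻ ((t ∈? nodes) ×-dec ¬? (s ~? t)) (edgeRule s t) r r∈)
      where
      t : Shape
      t = mapAtom (varPos (body τ) s) h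
      byRule : (t ∈ nodes × ¬ s ~ t) × r ≡ edgeRule s t → RuleOrigin r
      byRule ((t∈ , ¬s~t) , r≡) = fromEdge s t (lose τ∈ (s∈ , ∈ₚ.∈-map⁺ (mapAtom (varPos (body τ) s)) h∈)) t∈ ¬s~t r≡

    originBodyShape : ∀ {r} τ → τ ∈ T →
      Σ Shape (λ s → s ∈ bodyShapes (body τ) × r ∈ concatMap (λ h → edgeRuleIf s (mapAtom (varPos (body τ) s) h)) (head τ)) → RuleOrigin r
    originBodyShape τ τ∈ (s , s∈ , r∈) = originHead τ τ∈ s s∈ (find (∈ₚ.∈-concatMap⁻ _ {xs = head τ} r∈))

    originTGD : ∀ {r} → Σ TGD (λ τ → τ ∈ T × r ∈ edgeRulesOf τ) → RuleOrigin r
    originTGD (τ , τ∈ , r∈) = originBodyShape τ τ∈ (find (∈ₚ.∈-concatMap⁻ _ {xs = bodyShapes (body τ)} r∈))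

    originAdded : ∀ {r} → (r ∈ entryRules ⊎ r ∈ edgeRules) ⊎ r ∈ allExitRules → RuleOrigin r
    originAdded (inj₁ (inj₁ r∈)) = originEntry (find (∈ₚ.∈-concatMap⁻ (λ P → map entryRule (entryShapes P)) {xs = preds} r∈))
    originAdded (inj₁ (inj₂ r∈)) = originTGD (find (∈ₚ.∈-concatMap⁻ edgeRulesOf {xs = T} r∈))
    originAdded (inj₂ r∈) = originExit (find (∈ₚ.∈-concatMap⁻ exitRules {xs = preds} r∈))
      where
      originExit : ∀ {r} → Σ ℕ (λ S → S ∈ preds × r ∈ exitRules S) → RuleOrigin r
      originExit (S , S∈ , r∈S) = fromExit S S∈ r∈S

    originΠ : ∀ {r} → Σ Rule (λ r₀ → r₀ ∈ Π × r ≡ redirect r₀) → RuleOrigin r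
    originΠ (r₀ , r₀∈ , r≡) = fromΠ r₀ r₀∈ r≡

  ruleOrigin : ∀ {r} → r ∈ Π′ → RuleOrigin r
  ruleOrigin r∈ = [ (λ r∈Π → originΠ (∈ₚ.∈-map⁻ redirect r∈Π)) ,
                     (λ r∈′ → originAdded (Sum.map₁ (∈ₚ.∈-++⁻ entryRules) (∈ₚ.∈-++⁻ (entryRules ++ edgeRules) r∈′))) ]′
                   (∈ₚ.∈-++⁻ (map redirect Π) r∈)

  g<fresh : g < fresh
  g<fresh = s≤s (⊥≤max g (concatMap ruleIdbNames Π))

  head<fresh : ∀ r0 → r0 ∈ Π → headPred r0 < fresh
  head<fresh r0 m = s≤s (All.lookup (xs≤max g (concatMap ruleIdbNames Π)) (∈ₚ.∈-concatMap⁺ ruleIdbNames (lose m (here refl))))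

  bodyIdb<fresh : ∀ r0 → r0 ∈ Π → ∀ {p xs} → idb p xs ∈ bodyAtoms r0 → p < fresh
  bodyIdb<fresh r0 m bm = s≤s (All.lookup (xs≤max g (concatMap ruleIdbNames Π))
    (∈ₚ.∈-concatMap⁺ ruleIdbNames (lose m (there (idbNames-∈ (bodyAtoms r0) bm)))))

  fresh≤nodePred : ∀ t → fresh ≤ nodePred t
  fresh≤nodePred t = ℕₚ.m≤m+n fresh (classIndex t)

  high≤binPred : ∀ S → fresh + #nodes ≤ binPred S
  high≤binPred S = ℕₚ.m≤m+n (fresh + #nodes) (2 * S)

  high≤unPred : ∀ S → fresh + #nodes ≤ unPred S
  high≤unPred S = ℕₚ.m≤m+n (fresh + #nodes) (suc (2 * S))

  binPred-injective : ∀ {S S'} → binPred S ≡ binPred S' → S ≡ S'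
  binPred-injective e = ℕₚ.*-cancelˡ-≡ _ _ 2 (ℕₚ.+-cancelˡ-≡ (fresh + #nodes) _ _ e)

  unPred-injective : ∀ {S S'} → unPred S ≡ unPred S' → S ≡ S'
  unPred-injective e = ℕₚ.*-cancelˡ-≡ _ _ 2 (ℕₚ.suc-injective (ℕₚ.+-cancelˡ-≡ (fresh + #nodes) _ _ e))

  binPred≢unPred : ∀ S S' → ¬ binPred S ≡ unPred S'
  binPred≢unPred S S' e = ℕₚ.even≢odd S S' (ℕₚ.+-cancelˡ-≡ (fresh + #nodes) _ _ e)

  entryRule∈ : ∀ {gh} → gh ∈ entries → entryRule gh ∈ Π′
  entryRule∈ gh∈ = viaPred (find (∈ₚ.∈-concatMap⁻ entryShapes {xs = preds} gh∈))
    where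
    viaPred : ∀ {gh} → Σ ℕ (λ P → P ∈ preds × gh ∈ entryShapes P) → entryRule gh ∈ Π′
    viaPred (P , P∈ , gh∈P) = ∈ₚ.∈-++⁺ʳ (map redirect Π) (∈ₚ.∈-++⁺ˡ (∈ₚ.∈-++⁺ˡ
      (∈ₚ.∈-concatMap⁺ (λ P → map entryRule (entryShapes P)) (lose P∈ (∈ₚ.∈-map⁺ entryRule gh∈P)))))

  edgeRule∈ : ∀ {s t} → Step s t → t ∈ nodes → ¬ s ~ t → edgeRule s t ∈ Π′
  edgeRule∈ {s} {t} step t∈ ¬s~t = viaTGD (find step)
    where
    viaHead : ∀ τ → τ ∈ T → s ∈ bodyShapes (body τ) → Σ (Atom (Fin 2)) (λ h → h ∈ head τ × t ≡ mapAtom (varPos (body τ) s) h) →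
      edgeRule s t ∈ Π′
    viaHead τ τ∈ s∈ (h , h∈ , refl) = ∈ₚ.∈-++⁺ʳ (map redirect Π) (∈ₚ.∈-++⁺ˡ (∈ₚ.∈-++⁺ʳ entryRules
      (∈ₚ.∈-concatMap⁺ edgeRulesOf (lose τ∈ (∈ₚ.∈-concatMap⁺ _ (lose s∈ (∈ₚ.∈-concatMap⁺ _ (lose h∈
        (∈listIf ((t ∈? nodes) ×-dec ¬? (s ~? t)) (edgeRule s t) (t∈ , ¬s~t))))))))))
    viaTGD : Σ TGD (λ τ → τ ∈ T × TGDStep τ s t) → edgeRule s t ∈ Π′
    viaTGD (τ , τ∈ , (s∈ , t∈τ)) = viaHead τ τ∈ s∈ (∈ₚ.∈-map⁻ (mapAtom (varPos (body τ) s)) t∈τ)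

  exitRule∈ : ∀ {S r} → S ∈ preds → r ∈ exitRules S → r ∈ Π′
  exitRule∈ S∈ r∈ = ∈ₚ.∈-++⁺ʳ (map redirect Π) (∈ₚ.∈-++⁺ʳ (entryRules ++ edgeRules) (∈ₚ.∈-concatMap⁺ exitRules (lose S∈ r∈)))

  exitRule-head : ∀ {S r} → r ∈ exitRules S → fresh + #nodes ≤ headPred r
  exitRule-head {S} (here refl) = high≤binPred S
  exitRule-head {S} (there (here refl)) = high≤binPred S
  exitRule-head {S} (there (there (here refl))) = high≤binPred S
  exitRule-head {S} (there (there (there (here refl)))) = high≤binPred S
  exitRule-head {S} (there (there (there (there (here refl))))) = high≤unPred S
  exitRule-head {S} (there (there (there (there (there (here refl)))))) = high≤unPred S

  <⇒≱ : ∀ {a b} → a < b → b ≤ a → ⊥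
  <⇒≱ a<b b≤a = ℕₚ.<-irrefl refl (ℕₚ.<-≤-trans a<b b≤a)

  module Semantics (A : Data) where
    open Entailment T A
    open Completion T A

    NodeFact : Shape → ℕ → ℕ → Set
    NodeFact t a b = Σ Shape λ gh → gh ∈ entries × Path gh t × mapAtom (ground a b) gh ∈ A

    args₂∈ind : ∀ {a b} → a ∈ ind A → b ∈ ind A → ∀ i → args₂ a b i ∈ ind A
    args₂∈ind am bm zero = am
    args₂∈ind am bm (suc zero) = bm

    entryAtom : ∀ {gh} a b → gh ∈ entries → mapAtom (args₂ a b) (mapAtom entryVar gh) ≡ mapAtom (ground a b) gh
    entryAtom a b gh∈ = viaPred (find (∈ₚ.∈-concatMap⁻ entryShapes {xs = preds} gh∈))
      where
      viaPred : ∀ {gh} → Σ ℕ (λ P → P ∈ preds × gh ∈ entryShapes P) → mapAtom (args₂ a b) (mapAtom entryVar gh) ≡ mapAtom (ground a b) gh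
      viaPred (P , _ , here refl) = refl
      viaPred (P , _ , there (here refl)) = refl
      viaPred (P , _ , there (there (here refl))) = refl

    derive-entry : ∀ {gh a b} → gh ∈ entries → a ∈ ind A → b ∈ ind A → mapAtom (ground a b) gh ∈ A →
      Derives Π′ A (nodePred gh) (a ∷ b ∷ [])
    derive-entry {gh} {a} {b} ghm am bm gA =
      apply (entryRule gh) (entryRule∈ ghm) (args₂ a b) (args₂∈ind am bm) (subst (_∈ A) (sym (entryAtom a b ghm)) gA ∷ [])

    derive-step : ∀ {a b s s1} → a ∈ ind A → b ∈ ind A → Step s s1 → s1 ∈ nodes →
      Derives Π′ A (nodePred s) (a ∷ b ∷ []) → Derives Π′ A (nodePred s1) (a ∷ b ∷ [])
    derive-step {a} {b} {s} {s1} am bm stp s1U d = byClass (s ~? s1)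
      where
      byClass : Dec (s ~ s1) → Derives Π′ A (nodePred s1) (a ∷ b ∷ [])
      byClass (yes s~s1) = subst (λ p → Derives Π′ A p (a ∷ b ∷ [])) (nodePred-~ s~s1) d
      byClass (no ne) = apply (edgeRule s s1) (edgeRule∈ stp s1U ne) (args₂ a b) (args₂∈ind am bm) (d ∷ [])

    derive-path : ∀ {a b s t} → a ∈ ind A → b ∈ ind A → t ∈ nodes → Derives Π′ A (nodePred s) (a ∷ b ∷ []) → Path s t →
      Derives Π′ A (nodePred t) (a ∷ b ∷ [])
    derive-path am bm tU d ε = d
    derive-path am bm tU d (x ◅ ε) = derive-step am bm x tU d
    derive-path am bm tU d (x ◅ (y ◅ ys)) = derive-path am bm tU (derive-step am bm x (stepSource∈nodes y) d) (y ◅ ys)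

    derive-node : ∀ {t a b} → NodeFact t a b → a ∈ ind A → b ∈ ind A → t ∈ nodes → Derives Π′ A (nodePred t) (a ∷ b ∷ [])
    derive-node (gh , ghm , r , gA) am bm tU = derive-path am bm tU (derive-entry ghm am bm gA) r

    mapAtom-args₂ : ∀ (σ : Fin 2 → ℕ) (α : Atom (Fin 2)) → mapAtom σ α ≡ mapAtom (args₂ (σ v₀) (σ v₁)) α
    mapAtom-args₂ σ α = mapAtom-cong _ _ α λ { zero _ → refl ; (suc zero) _ → refl }

    NodeResult : Shape → List ℕ → Set
    NodeResult t xs = Σ ℕ λ a → Σ ℕ λ b → xs ≡ a ∷ b ∷ [] × NodeFact t a b

    nodeFact-step : ∀ {s t t' a0 b0} → Step s t' → t' ~ t → NodeResult s (a0 ∷ b0 ∷ []) → NodeFact t a0 b0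
    nodeFact-step stp tt' (a' , b' , refl , (gh , ghm , r1 , gA)) = gh , ghm , r1 ◅◅ (stp ◅ proj₁ tt') , gA

    mutual
      node-sound : ∀ {p xs} → Derives Π′ A p xs → ∀ t → t ∈ nodes → p ≡ nodePred t → NodeResult t xs
      node-sound (apply r rm σ σi bs) t tU e = node-sound-rule r σ σi bs (ruleOrigin rm) t tU e

      node-sound-rule : ∀ r (σ : Fin (nvars r) → ℕ) → (∀ i → σ i ∈ ind A) → All (BodySat Π′ A σ) (bodyAtoms r) → RuleOrigin r →
        ∀ t → t ∈ nodes → headPred r ≡ nodePred t → NodeResult t (map σ (headArgs r))
      node-sound-rule r σ σi bs (fromΠ r0 r0m refl) t tU e = ⊥-elim (<⇒≱ (head<fresh r0 r0m) (subst (fresh ≤_) (sym e) (fresh≤nodePred t)))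
      node-sound-rule r σ σi bs (fromExit S Sm m) t tU e = ⊥-elim (<⇒≱ (nodePred< tU) (subst (fresh + #nodes ≤_) e (exitRule-head m)))
      node-sound-rule r σ σi (bA ∷ []) (fromEntry gh ghm refl) t tU e = σ v₀ , σ v₁ , refl ,
             (gh , ghm , proj₁ (nodePred-injective (entry∈nodes ghm) e) , subst (_∈ A) (entryAtom (σ v₀) (σ v₁) ghm) (subst (_∈ A) (mapAtom-args₂ σ _) bA))
      node-sound-rule r σ σi (bd ∷ []) (fromEdge s t' stp t'U nst refl) t tU e =
        σ v₀ , σ v₁ , refl , nodeFact-step stp (nodePred-injective t'U e) (node-sound bd s (stepSource∈nodes stp) refl)

    nodeResult⇒fact : ∀ {t z1 z2} → NodeResult t (z1 ∷ z2 ∷ []) → NodeFact t z1 z2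
    nodeResult⇒fact (a , b , refl , ns) = ns

    nodeFact⇒completion : ∀ t β z1 z2 → t ∈ groundShapes β → z1 ∈ ind A → z2 ∈ ind A → NodeFact t z1 z2 → mapAtom (ground z1 z2) t ≡ β → β ∈ completion
    nodeFact⇒completion t β z1 z2 tm z1m z2m (gh , ghm , r , gA) eqβ = viaPred (find (∈ₚ.∈-concatMap⁻ entryShapes {xs = preds} ghm))
      where
      viaPred : Σ ℕ (λ P → P ∈ preds × gh ∈ entryShapes P) → β ∈ completion
      viaPred (P , Pm , ghP) = proj₂ (∈completion⇔certified β) (inj₂ (lose Pm (lose ghP (lose tm (r , z1 , z2 , z1m , z2m , gA , eqβ)))))

    BinResult : ℕ → List ℕ → Set
    BinResult S xs = Σ ℕ λ a → Σ ℕ λ b → xs ≡ a ∷ b ∷ [] × bin S a b ∈ completion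

    UnResult : ℕ → List ℕ → Set
    UnResult S xs = Σ ℕ λ a → xs ≡ a ∷ [] × un S a ∈ completion

    derived⇒completion : ∀ {t z1 z2} β → predSym β ∈ preds → t ∈ groundShapes β → z1 ∈ ind A → z2 ∈ ind A →
      Derives Π′ A (nodePred t) (z1 ∷ z2 ∷ []) → mapAtom (ground z1 z2) t ≡ β → β ∈ completion
    derived⇒completion {t} β β∈ t∈ z1∈ z2∈ d same = nodeFact⇒completion t β _ _ t∈ z1∈ z2∈
      (nodeResult⇒fact (node-sound d t (∈nodes β∈ (groundShape∈nodesOf β t∈)) refl)) same

    binExit-sound : ∀ S′ → S′ ∈ preds → ∀ {r} → r ∈ exitRules S′ → (σ : Fin (nvars r) → ℕ) → (∀ i → σ i ∈ ind A) →
      All (BodySat Π′ A σ) (bodyAtoms r) → ∀ S → headPred r ≡ binPred S → BinResult S (map σ (headArgs r))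
    binExit-sound S′ S∈ (here refl) σ σ∈ (d ∷ []) S same = σ v₀ , σ v₁ , refl ,
      subst (λ X → bin X (σ v₀) (σ v₁) ∈ completion) (binPred-injective same)
        (derived⇒completion (bin S′ (σ v₀) (σ v₁)) S∈ (there (here refl)) (σ∈ v₀) (σ∈ v₁) d refl)
    binExit-sound S′ S∈ (there (here refl)) σ σ∈ (d ∷ []) S same = σ v₀ , σ v₁ , refl ,
      subst (λ X → bin X (σ v₀) (σ v₁) ∈ completion) (binPred-injective same)
        (derived⇒completion (bin S′ (σ v₀) (σ v₁)) S∈ (there (there (here refl))) (σ∈ v₁) (σ∈ v₀) d refl)
    binExit-sound S′ S∈ (there (there (here refl))) σ σ∈ (d ∷ []) S same = σ v₀ , σ v₀ , refl ,
      subst (λ X → bin X (σ v₀) (σ v₀) ∈ completion) (binPred-injective same)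
        (derived⇒completion (bin S′ (σ v₀) (σ v₀)) S∈ (here refl) (σ∈ v₀) (σ∈ v₁) d refl)
    binExit-sound S′ S∈ (there (there (there (here refl)))) σ σ∈ (d ∷ []) S same = σ v₀ , σ v₀ , refl ,
      subst (λ X → bin X (σ v₀) (σ v₀) ∈ completion) (binPred-injective same)
        (derived⇒completion (bin S′ (σ v₀) (σ v₀)) S∈ (there (there (there (here refl)))) (σ∈ v₁) (σ∈ v₀) d refl)
    binExit-sound S′ S∈ (there (there (there (there (here refl))))) σ σ∈ _ S same = ⊥-elim (binPred≢unPred S S′ (sym same))
    binExit-sound S′ S∈ (there (there (there (there (there (here refl)))))) σ σ∈ _ S same = ⊥-elim (binPred≢unPred S S′ (sym same))

    unExit-sound : ∀ S′ → S′ ∈ preds → ∀ {r} → r ∈ exitRules S′ → (σ : Fin (nvars r) → ℕ) → (∀ i → σ i ∈ ind A) →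
      All (BodySat Π′ A σ) (bodyAtoms r) → ∀ S → headPred r ≡ unPred S → UnResult S (map σ (headArgs r))
    unExit-sound S′ S∈ (here refl) σ σ∈ _ S same = ⊥-elim (binPred≢unPred S′ S same)
    unExit-sound S′ S∈ (there (here refl)) σ σ∈ _ S same = ⊥-elim (binPred≢unPred S′ S same)
    unExit-sound S′ S∈ (there (there (here refl))) σ σ∈ _ S same = ⊥-elim (binPred≢unPred S′ S same)
    unExit-sound S′ S∈ (there (there (there (here refl)))) σ σ∈ _ S same = ⊥-elim (binPred≢unPred S′ S same)
    unExit-sound S′ S∈ (there (there (there (there (here refl))))) σ σ∈ (d ∷ []) S same = σ v₀ , refl ,
      subst (λ X → un X (σ v₀) ∈ completion) (unPred-injective same)
        (derived⇒completion (un S′ (σ v₀)) S∈ (here refl) (σ∈ v₀) (σ∈ v₁) d refl)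
    unExit-sound S′ S∈ (there (there (there (there (there (here refl)))))) σ σ∈ (d ∷ []) S same = σ v₀ , refl ,
      subst (λ X → un X (σ v₀) ∈ completion) (unPred-injective same)
        (derived⇒completion (un S′ (σ v₀)) S∈ (there (here refl)) (σ∈ v₁) (σ∈ v₀) d refl)

    high-rule : ∀ {r} → RuleOrigin r → ∀ h → fresh + #nodes ≤ h → headPred r ≡ h → (Σ ℕ λ S' → S' ∈ preds × r ∈ exitRules S')
    high-rule (fromΠ r0 r0m refl) h le e = ⊥-elim (<⇒≱ (ℕₚ.<-≤-trans (head<fresh r0 r0m) (ℕₚ.m≤m+n fresh #nodes)) (subst (fresh + #nodes ≤_) (sym e) le))
    high-rule (fromEntry gh ghm refl) h le e = ⊥-elim (<⇒≱ (nodePred< (entry∈nodes ghm)) (subst (fresh + #nodes ≤_) (sym e) le))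
    high-rule (fromEdge s t _ tU _ refl) h le e = ⊥-elim (<⇒≱ (nodePred< tU) (subst (fresh + #nodes ≤_) (sym e) le))
    high-rule (fromExit S Sm m) h le e = S , Sm , m

    binPred-sound : ∀ {p xs} → Derives Π′ A p xs → ∀ S → p ≡ binPred S → BinResult S xs
    binPred-sound (apply r rm σ σi bs) S e = viaExit (high-rule (ruleOrigin rm) _ (high≤binPred S) e)
      where
      viaExit : (Σ ℕ λ S' → S' ∈ preds × r ∈ exitRules S') → BinResult S (map σ (headArgs r))
      viaExit (S' , Sm' , m) = binExit-sound S' Sm' m σ σi bs S e

    unPred-sound : ∀ {p xs} → Derives Π′ A p xs → ∀ S → p ≡ unPred S → UnResult S xs
    unPred-sound (apply r rm σ σi bs) S e = viaExit (high-rule (ruleOrigin rm) _ (high≤unPred S) e)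
      where
      viaExit : (Σ ℕ λ S' → S' ∈ preds × r ∈ exitRules S') → UnResult S (map σ (headArgs r))
      viaExit (S' , Sm' , m) = unExit-sound S' Sm' m σ σi bs S e

    binExit-complete : ∀ {S} → S ∈ preds → ∀ t → t ∈ groundShapes (bin S 0 0) → ∀ z1 z2 → z1 ∈ ind A → z2 ∈ ind A →
      Derives Π′ A (nodePred t) (z1 ∷ z2 ∷ []) → ∀ a b → mapAtom (ground z1 z2) t ≡ bin S a b → Derives Π′ A (binPred S) (a ∷ b ∷ [])
    binExit-complete Sm _ (here refl) z1 z2 z1m z2m d .z1 .z1 refl =
      apply _ (exitRule∈ Sm (there (there (here refl)))) (args₂ z1 z2) (args₂∈ind z1m z2m) (d ∷ [])
    binExit-complete Sm _ (there (here refl)) z1 z2 z1m z2m d .z1 .z2 refl =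
      apply _ (exitRule∈ Sm (here refl)) (args₂ z1 z2) (args₂∈ind z1m z2m) (d ∷ [])
    binExit-complete Sm _ (there (there (here refl))) z1 z2 z1m z2m d .z2 .z1 refl =
      apply _ (exitRule∈ Sm (there (here refl))) (args₂ z2 z1) (args₂∈ind z2m z1m) (d ∷ [])
    binExit-complete Sm _ (there (there (there (here refl)))) z1 z2 z1m z2m d .z2 .z2 refl =
      apply _ (exitRule∈ Sm (there (there (there (here refl))))) (args₂ z2 z1) (args₂∈ind z2m z1m) (d ∷ [])

    unExit-complete : ∀ {S} → S ∈ preds → ∀ t → t ∈ groundShapes (un S 0) → ∀ z1 z2 → z1 ∈ ind A → z2 ∈ ind A →
      Derives Π′ A (nodePred t) (z1 ∷ z2 ∷ []) → ∀ a → mapAtom (ground z1 z2) t ≡ un S a → Derives Π′ A (unPred S) (a ∷ [])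
    unExit-complete Sm _ (here refl) z1 z2 z1m z2m d .z1 refl =
      apply _ (exitRule∈ Sm (there (there (there (there (here refl)))))) (args₂ z1 z2) (args₂∈ind z1m z2m) (d ∷ [])
    unExit-complete Sm _ (there (here refl)) z1 z2 z1m z2m d .z2 refl =
      apply _ (exitRule∈ Sm (there (there (there (there (there (here refl))))))) (args₂ z2 z1) (args₂∈ind z2m z1m) (d ∷ [])

    DerivedShape : Atom ℕ → Set
    DerivedShape β = Σ Shape λ t → t ∈ groundShapes β × Σ ℕ λ z1 → Σ ℕ λ z2 → z1 ∈ ind A × z2 ∈ ind A ×
      Derives Π′ A (nodePred t) (z1 ∷ z2 ∷ []) × mapAtom (ground z1 z2) t ≡ β

    witnessed⇒derivedShape : ∀ {β} → predSym β ∈ preds → Witnessed β → DerivedShape β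
    witnessed⇒derivedShape {β} β∈ w = viaPred (find w)
      where
      viaWitness : ∀ {gh} → gh ∈ entries → Σ Shape (λ t → t ∈ groundShapes β × Witness gh t β) → DerivedShape β
      viaWitness {gh} gh∈ (t , t∈ , (path , z1 , z2 , z1∈ , z2∈ , g∈ , same)) =
        t , t∈ , z1 , z2 , z1∈ , z2∈ , derive-node (gh , gh∈ , path , g∈) z1∈ z2∈ (∈nodes β∈ (groundShape∈nodesOf β t∈)) , same
      viaEntry : ∀ {P} → P ∈ preds → Σ Shape (λ gh → gh ∈ entryShapes P × Any (λ t → Witness gh t β) (groundShapes β)) → DerivedShape β
      viaEntry P∈ (gh , gh∈ , w′) = viaWitness (∈ₚ.∈-concatMap⁺ entryShapes (lose P∈ gh∈)) (find w′)
      viaPred : Σ ℕ (λ P → P ∈ preds × Any (λ gh → Any (λ t → Witness gh t β) (groundShapes β)) (entryShapes P)) → DerivedShape β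
      viaPred (P , P∈ , w′) = viaEntry P∈ (find w′)

    binPred-complete : ∀ {S a b} → S ∈ preds → a ∈ ind A → b ∈ ind A → bin S a b ∈ completion → Derives Π′ A (binPred S) (a ∷ b ∷ [])
    binPred-complete {S} {a} {b} S∈ a∈ b∈ β∈ = fromCertificate (proj₁ (∈completion⇔certified _) β∈)
      where
      fromShape : DerivedShape (bin S a b) → Derives Π′ A (binPred S) (a ∷ b ∷ [])
      fromShape (t , t∈ , z1 , z2 , z1∈ , z2∈ , d , same) = binExit-complete S∈ t t∈ z1 z2 z1∈ z2∈ d a b same
      fromCertificate : Certified (bin S a b) → Derives Π′ A (binPred S) (a ∷ b ∷ [])
      fromCertificate (inj₁ β∈A) = apply _ (exitRule∈ S∈ (here refl)) (args₂ a b) (args₂∈ind a∈ b∈)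
        (derive-node (bin S c₁ c₂ , ∈ₚ.∈-concatMap⁺ entryShapes (lose S∈ (there (there (here refl)))) , ε , β∈A) a∈ b∈
           (∈nodes S∈ (there (there (there (here refl))))) ∷ [])
      fromCertificate (inj₂ w) = fromShape (witnessed⇒derivedShape S∈ w)

    unPred-complete : ∀ {S a} → S ∈ preds → a ∈ ind A → un S a ∈ completion → Derives Π′ A (unPred S) (a ∷ [])
    unPred-complete {S} {a} S∈ a∈ β∈ = fromCertificate (proj₁ (∈completion⇔certified _) β∈)
      where
      fromShape : DerivedShape (un S a) → Derives Π′ A (unPred S) (a ∷ [])
      fromShape (t , t∈ , z1 , z2 , z1∈ , z2∈ , d , same) = unExit-complete S∈ t t∈ z1 z2 z1∈ z2∈ d a same
      fromCertificate : Certified (un S a) → Derives Π′ A (unPred S) (a ∷ [])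
      fromCertificate (inj₁ β∈A) = apply _ (exitRule∈ S∈ (there (there (there (there (here refl)))))) (args₂ a a) (args₂∈ind a∈ a∈)
        (derive-node (un S c₁ , ∈ₚ.∈-concatMap⁺ entryShapes (lose S∈ (here refl)) , ε , β∈A) a∈ a∈ (∈nodes S∈ (here refl)) ∷ [])
      fromCertificate (inj₂ w) = fromShape (witnessed⇒derivedShape S∈ w)

    completion-outside : ∀ {β} → β ∈ completion → ¬ predSym β ∈ preds → β ∈ A
    completion-outside {β} β∈ β∉ = [ (λ β∈A → β∈A) ,
      (λ β∈F → ⊥-elim (β∉ (groundAtoms-pred (ontPreds T) (ind A) β (filtered-candidate {β} β∈F)))) ]′ (∈ₚ.∈-++⁻ A β∈)

    redirectUn-sat : ∀ {k} (σ : Fin k → ℕ) → (∀ i → σ i ∈ ind A) → ∀ S u (d : Dec (S ∈ preds)) →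
      un S (σ u) ∈ completion → BodySat Π′ A σ (redirectUn S u d)
    redirectUn-sat σ σi S u (yes Sm) m = unPred-complete Sm (σi u) m
    redirectUn-sat σ σi S u (no nS) m = completion-outside m nS

    redirectBin-sat : ∀ {k} (σ : Fin k → ℕ) → (∀ i → σ i ∈ ind A) → ∀ S u w (d : Dec (S ∈ preds)) →
      bin S (σ u) (σ w) ∈ completion → BodySat Π′ A σ (redirectBin S u w d)
    redirectBin-sat σ σi S u w (yes Sm) m = binPred-complete Sm (σi u) (σi w) m
    redirectBin-sat σ σi S u w (no nS) m = completion-outside m nS

    mutual
      simulate : ∀ {p xs} → Derives Π completion p xs → Derives Π′ A p xs
      simulate (apply r rm σ σi bs) = apply (redirect r) (∈ₚ.∈-++⁺ˡ (∈ₚ.∈-map⁺ redirect rm)) σ (λ i → ind-completion⁻ (σi i))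
        (simulate-body σ (λ i → ind-completion⁻ (σi i)) (bodyAtoms r) bs)

      simulate-body : ∀ {k} (σ : Fin k → ℕ) → (∀ i → σ i ∈ ind A) → (bs : List (BodyAtom k)) →
        All (BodySat Π completion σ) bs → All (BodySat Π′ A σ) (map redirectAtom bs)
      simulate-body σ σi [] [] = []
      simulate-body σ σi (b ∷ bs) (x ∷ xs) = simulate-atom σ σi b x ∷ simulate-body σ σi bs xs

      simulate-atom : ∀ {k} (σ : Fin k → ℕ) → (∀ i → σ i ∈ ind A) → (b : BodyAtom k) →
        BodySat Π completion σ b → BodySat Π′ A σ (redirectAtom b)
      simulate-atom σ σi (edb (un S u)) x = redirectUn-sat σ σi S u (S ∈ℕ.∈? preds) x
      simulate-atom σ σi (edb (bin S u w)) x = redirectBin-sat σ σi S u w (S ∈ℕ.∈? preds) x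
      simulate-atom σ σi (idb p xs) x = simulate x
      simulate-atom σ σi (eqb i j) x = x

    redirectUn-sound : ∀ {k} (σ : Fin k → ℕ) → ∀ S u (d : Dec (S ∈ preds)) →
      BodySat Π′ A σ (redirectUn S u d) → un S (σ u) ∈ completion
    redirectUn-sound σ S u (yes _) d = inCompletion (unPred-sound d S refl)
      where inCompletion : UnResult S (σ u ∷ []) → un S (σ u) ∈ completion
            inCompletion (_ , refl , β∈) = β∈
    redirectUn-sound σ S u (no _) x = ∈ₚ.∈-++⁺ˡ x

    redirectBin-sound : ∀ {k} (σ : Fin k → ℕ) → ∀ S u w (d : Dec (S ∈ preds)) →
      BodySat Π′ A σ (redirectBin S u w d) → bin S (σ u) (σ w) ∈ completion
    redirectBin-sound σ S u w (yes _) d = inCompletion (binPred-sound d S refl)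
      where inCompletion : BinResult S (σ u ∷ σ w ∷ []) → bin S (σ u) (σ w) ∈ completion
            inCompletion (_ , _ , refl , β∈) = β∈
    redirectBin-sound σ S u w (no _) x = ∈ₚ.∈-++⁺ˡ x

    mutual
      reflect : ∀ {p xs} → Derives Π′ A p xs → p < fresh → Derives Π completion p xs
      reflect (apply r rm σ σi bs) lt = reflect-rule r σ σi bs (ruleOrigin rm) lt

      reflect-rule : ∀ r (σ : Fin (nvars r) → ℕ) → (∀ i → σ i ∈ ind A) → All (BodySat Π′ A σ) (bodyAtoms r) → RuleOrigin r →
        headPred r < fresh → Derives Π completion (headPred r) (map σ (headArgs r))
      reflect-rule r σ σi bs (fromΠ r0 r0m refl) lt =
        apply r0 r0m σ (λ i → ind-completion⁺ (σi i)) (reflect-body σ (bodyAtoms r0) (bodyIdb<fresh r0 r0m) bs)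
      reflect-rule r σ σi bs (fromEntry gh ghm refl) lt = ⊥-elim (<⇒≱ lt (fresh≤nodePred gh))
      reflect-rule r σ σi bs (fromEdge s t _ _ _ refl) lt = ⊥-elim (<⇒≱ lt (fresh≤nodePred t))
      reflect-rule r σ σi bs (fromExit S Sm m) lt = ⊥-elim (<⇒≱ lt (ℕₚ.≤-trans (ℕₚ.m≤m+n fresh #nodes) (exitRule-head m)))

      reflect-body : ∀ {k} (σ : Fin k → ℕ) → (bs : List (BodyAtom k)) → (∀ {p xs} → idb p xs ∈ bs → p < fresh) →
        All (BodySat Π′ A σ) (map redirectAtom bs) → All (BodySat Π completion σ) bs
      reflect-body σ [] f [] = []
      reflect-body σ (b ∷ bs) f (x ∷ xs) = reflect-atom σ b (λ e → f (here e)) x ∷ reflect-body σ bs (λ m → f (there m)) xs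

      reflect-atom : ∀ {k} (σ : Fin k → ℕ) → (b : BodyAtom k) → (∀ {p xs} → idb p xs ≡ b → p < fresh) →
        BodySat Π′ A σ (redirectAtom b) → BodySat Π completion σ b
      reflect-atom σ (edb (un S u)) f x = redirectUn-sound σ S u (S ∈ℕ.∈? preds) x
      reflect-atom σ (edb (bin S u w)) f x = redirectBin-sound σ S u w (S ∈ℕ.∈? preds) x
      reflect-atom σ (idb p xs) f x = reflect x (f refl)
      reflect-atom σ (eqb i j) f x = x

  redirectUn-idb : ∀ {k} S (u : Fin k) (d : Dec (S ∈ preds)) {p xs} → idb p xs ≡ redirectUn S u d → p ≡ unPred S
  redirectUn-idb S u (yes _) e = idb-injective e
  redirectUn-idb S u (no _) ()

  redirectBin-idb : ∀ {k} S (u w : Fin k) (d : Dec (S ∈ preds)) {p xs} → idb p xs ≡ redirectBin S u w d → p ≡ binPred S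
  redirectBin-idb S u w (yes _) e = idb-injective e
  redirectBin-idb S u w (no _) ()

  data RedirectedIdb {k : ℕ} (p : ℕ) : BodyAtom k → Set where
    viaUn : ∀ S u → p ≡ unPred S → RedirectedIdb p (edb (un S u))
    viaBin : ∀ S u w → p ≡ binPred S → RedirectedIdb p (edb (bin S u w))
    viaIdb : ∀ xs → RedirectedIdb p (idb p xs)

  redirectAtom-idb : ∀ {k} (b : BodyAtom k) {p xs} → idb p xs ≡ redirectAtom b → RedirectedIdb p b
  redirectAtom-idb (edb (un S u)) e = viaUn S u (redirectUn-idb S u (S ∈ℕ.∈? preds) e)
  redirectAtom-idb (edb (bin S u w)) e = viaBin S u w (redirectBin-idb S u w (S ∈ℕ.∈? preds) e)
  redirectAtom-idb (idb q ys) refl = viaIdb ys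
  redirectAtom-idb (eqb i j) ()

  exitRule-body : ∀ {S r} → S ∈ preds → r ∈ exitRules S → ∀ {p xs} → idb p xs ∈ bodyAtoms r → Σ Shape λ t → t ∈ nodes × p ≡ nodePred t
  exitRule-body Sm (here refl) (here e) = _ , ∈nodes Sm (there (there (there (here refl)))) , idb-injective e
  exitRule-body Sm (there (here refl)) (here e) = _ , ∈nodes Sm (there (there (there (there (there (here refl)))))) , idb-injective e
  exitRule-body Sm (there (there (here refl))) (here e) = _ , ∈nodes Sm (there (there (here refl))) , idb-injective e
  exitRule-body Sm (there (there (there (here refl)))) (here e) = _ , ∈nodes Sm (there (there (there (there (there (there (here refl))))))) , idb-injective e
  exitRule-body Sm (there (there (there (there (here refl))))) (here e) = _ , ∈nodes Sm (here refl) , idb-injective e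
  exitRule-body Sm (there (there (there (there (there (here refl)))))) (here e) = _ , ∈nodes Sm (there (here refl)) , idb-injective e

  -- Rules of Π keep their ranks, shifted above all new predicates; the
  -- completed data predicates come next; and a node predicate is ranked by the
  -- number of nodes reaching its class, which grows along every edge rule since
  -- edge rules only connect different classes.
  module Ranking (nr : Nonrecursive Π) where
    rankΠ : ℕ → ℕ
    rankΠ = proj₁ nr

    ancestors : Shape → ℕ
    ancestors v = count (λ w → path? w v) nodes

    rankNode : ℕ → ℕ
    rankNode p = count (λ w → Any.any? (λ v → (nodePred v ℕ.≟ p) ×-dec path? w v) nodes) nodes

    rank : ℕ → ℕ
    rank p = ifDec (p ℕ.<? fresh) (suc (suc #nodes) + rankΠ p) (ifDec (p ℕ.<? fresh + #nodes) (rankNode p) (suc #nodes))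

    rank-low : ∀ {p} → p < fresh → rank p ≡ suc (suc #nodes) + rankΠ p
    rank-low {p} lt = ifDec-yes (p ℕ.<? fresh) lt

    rank-high : ∀ {p} → fresh + #nodes ≤ p → rank p ≡ suc #nodes
    rank-high {p} le = trans (ifDec-no (p ℕ.<? fresh) (λ lt → <⇒≱ lt (ℕₚ.≤-trans (ℕₚ.m≤m+n fresh #nodes) le)))
                            (ifDec-no (p ℕ.<? fresh + #nodes) (λ lt → <⇒≱ lt le))

    rank-node : ∀ {v} → v ∈ nodes → rank (nodePred v) ≡ ancestors v
    rank-node {v} vU = trans (ifDec-no (nodePred v ℕ.<? fresh) (λ lt → <⇒≱ lt (fresh≤nodePred v)))
      (trans (ifDec-yes (nodePred v ℕ.<? fresh + #nodes) (nodePred< vU))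
        (count-cong _ _ toClass (λ w path → lose vU (refl , path)) nodes))
      where
      viaClassmate : ∀ {w} → Σ Shape (λ v′ → v′ ∈ nodes × (nodePred v′ ≡ nodePred v × Path w v′)) → Path w v
      viaClassmate (v′ , v′∈ , same , path) = path ◅◅ proj₁ (nodePred-injective v′∈ same)
      toClass : ∀ w → Any (λ v′ → nodePred v′ ≡ nodePred v × Path w v′) nodes → Path w v
      toClass w any = viaClassmate (find any)

    ancestors-step : ∀ {s t} → Step s t → t ∈ nodes → ¬ s ~ t → ancestors s < ancestors t
    ancestors-step stp tU nst = count-mono-< _ _ (λ w r → r ◅◅ (stp ◅ ε)) nodes (lose tU (ε , λ r → nst (stp ◅ ε , r)))

    rank-decreases : ∀ r → RuleOrigin r → (p : ℕ) (xs : List (Fin (nvars r))) → idb p xs ∈ bodyAtoms r → rank p < rank (headPred r)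
    rank-decreases r (fromΠ r₀ r₀∈ refl) p xs p∈ = viaRedirect (∈ₚ.∈-map⁻ redirectAtom p∈)
      where
      rank-head : rank (headPred r₀) ≡ suc (suc #nodes) + rankΠ (headPred r₀)
      rank-head = rank-low (head<fresh r₀ r₀∈)
      below-head : ∀ {q} → fresh + #nodes ≤ q → rank q < rank (headPred r₀)
      below-head high = subst₂ _<_ (sym (rank-high high)) (sym rank-head) (ℕₚ.m≤m+n (suc (suc #nodes)) _)
      byKind : ∀ b → b ∈ bodyAtoms r₀ → RedirectedIdb p b → rank p < rank (headPred r₀)
      byKind _ _ (viaUn S u refl) = below-head (high≤unPred S)
      byKind _ _ (viaBin S u w refl) = below-head (high≤binPred S)
      byKind _ b∈ (viaIdb ys) = subst₂ _<_ (sym (rank-low (bodyIdb<fresh r₀ r₀∈ b∈))) (sym rank-head)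
                                  (ℕₚ.+-monoʳ-< (suc (suc #nodes)) (proj₂ nr r₀ r₀∈ p ys b∈))
      viaRedirect : Σ (BodyAtom (nvars r₀)) (λ b → b ∈ bodyAtoms r₀ × idb p xs ≡ redirectAtom b) → rank p < rank (headPred r₀)
      viaRedirect (b , b∈ , same) = byKind b b∈ (redirectAtom-idb b same)
    rank-decreases r (fromEntry gh gh∈ refl) p xs (here ())
    rank-decreases r (fromEntry gh gh∈ refl) p xs (there ())
    rank-decreases r (fromEdge s t step t∈ ¬s~t refl) p xs (here same) =
      subst₂ _<_ (sym (trans (cong rank (idb-injective same)) (rank-node (stepSource∈nodes step)))) (sym (rank-node t∈))
        (ancestors-step step t∈ ¬s~t)
    rank-decreases r (fromEdge s t step t∈ ¬s~t refl) p xs (there ())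
    rank-decreases r (fromExit S S∈ r∈) p xs p∈ = viaNode (exitRule-body S∈ r∈ p∈)
      where
      viaNode : Σ Shape (λ t → t ∈ nodes × p ≡ nodePred t) → rank p < rank (headPred r)
      viaNode (t , t∈ , refl) = subst₂ _<_ (sym (rank-node t∈)) (sym (rank-high (exitRule-head r∈))) (s≤s (count≤length _ nodes))

    nonrecursive : Nonrecursive Π′
    nonrecursive = rank , λ r rm p xs bm → rank-decreases r (ruleOrigin rm) p xs bm

  bodyAtomSize-redirect : ∀ {k} (b : BodyAtom k) → bodyAtomSize (redirectAtom b) ≡ bodyAtomSize b
  bodyAtomSize-redirect (edb (un S u)) = go (S ∈ℕ.∈? preds)
    where go : (d : Dec (S ∈ preds)) → bodyAtomSize (redirectUn S u d) ≡ 2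
          go (yes _) = refl
          go (no _) = refl
  bodyAtomSize-redirect (edb (bin S u w)) = go (S ∈ℕ.∈? preds)
    where go : (d : Dec (S ∈ preds)) → bodyAtomSize (redirectBin S u w d) ≡ 3
          go (yes _) = refl
          go (no _) = refl
  bodyAtomSize-redirect (idb p xs) = refl
  bodyAtomSize-redirect (eqb i j) = refl

  bodySize-redirect : ∀ {k} (bs : List (BodyAtom k)) → sum (map bodyAtomSize (map redirectAtom bs)) ≡ sum (map bodyAtomSize bs)
  bodySize-redirect [] = refl
  bodySize-redirect (b ∷ bs) = cong₂ _+_ (bodyAtomSize-redirect b) (bodySize-redirect bs)

  progSize-redirect : ∀ (P : Program) → progSize (map redirect P) ≡ progSize P
  progSize-redirect [] = refl
  progSize-redirect (r ∷ P) = cong₂ _+_ (cong (suc (length (headArgs r)) +_) (bodySize-redirect (bodyAtoms r))) (progSize-redirect P)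

  progSize-edgeRuleIf : ∀ s t → progSize (edgeRuleIf s t) ≤ 6
  progSize-edgeRuleIf s t with (t ∈? nodes) ×-dec ¬? (s ~? t)
  ... | yes _ = ℕₚ.≤-refl
  ... | no _ = z≤n

  progSize-edgeRulesOf : ∀ τ → progSize (edgeRulesOf τ) ≤ 48 * suc (length (head τ))
  progSize-edgeRulesOf τ = ℕₚ.≤-trans (ℕₚ.≤-reflexive (progSize-concatMap _ (bodyShapes (body τ))))
    (ℕₚ.≤-trans (sum-map-≤ _ (bodyShapes (body τ)) (length (head τ) * 6) perShape)
      (ℕₚ.≤-trans (ℕₚ.*-monoˡ-≤ (length (head τ) * 6) (length-bodyShapes (body τ)))
        (ℕₚ.≤-trans (ℕₚ.≤-reflexive (trans (cong (8 *_) (ℕₚ.*-comm (length (head τ)) 6)) (sym (ℕₚ.*-assoc 8 6 (length (head τ))))))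
          (ℕₚ.*-monoʳ-≤ 48 (ℕₚ.n≤1+n _)))))
    where
    perShape : ∀ s → progSize (concatMap (λ h → edgeRuleIf s (mapAtom (varPos (body τ) s) h)) (head τ)) ≤ length (head τ) * 6
    perShape s = ℕₚ.≤-trans (ℕₚ.≤-reflexive (progSize-concatMap _ (head τ))) (sum-map-≤ _ (head τ) 6 (λ h → progSize-edgeRuleIf s _))

  progSize-added : progSize ((entryRules ++ edgeRules) ++ allExitRules) ≤ 100 * ontSize T
  progSize-added = ℕₚ.≤-trans (ℕₚ.≤-reflexive (trans (progSize-++ (entryRules ++ edgeRules) allExitRules)
                  (cong (_+ progSize allExitRules) (progSize-++ entryRules edgeRules))))
      (ℕₚ.≤-trans (ℕₚ.+-mono-≤ (ℕₚ.+-mono-≤ (ℕₚ.≤-reflexive entrySize) edgeSize) (ℕₚ.≤-reflexive exitSize))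
        (ℕₚ.≤-trans (ℕₚ.≤-reflexive (trans (cong (λ t → t * 17 + 48 * ontSize T + t * 34) (length-ontPreds T)) (arithmetic (ontSize T))))
           (ℕₚ.*-monoˡ-≤ (ontSize T) (s≤s (ℕₚ.n≤1+n 98)))))
    where
    entrySize : progSize entryRules ≡ length preds * 17
    entrySize = trans (progSize-concatMap (λ P → map entryRule (entryShapes P)) preds) (sum-map-const preds 17)
    exitSize : progSize allExitRules ≡ length preds * 34
    exitSize = trans (progSize-concatMap exitRules preds) (sum-map-const preds 34)
    edgeSize : progSize edgeRules ≤ 48 * ontSize T
    edgeSize = ℕₚ.≤-trans (ℕₚ.≤-reflexive (progSize-concatMap edgeRulesOf T))
      (ℕₚ.≤-trans (sum-map-mono _ _ T progSize-edgeRulesOf) (ℕₚ.≤-reflexive (sum-map-* (λ τ → suc (length (head τ))) T 48)))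
    arithmetic : ∀ t → t * 17 + 48 * t + t * 34 ≡ 99 * t
    arithmetic = solve-∀

  progSize-Π′ : progSize Π′ ≤ progSize Π + 100 * ontSize T
  progSize-Π′ = ℕₚ.≤-trans (ℕₚ.≤-reflexive (trans (progSize-++ (map redirect Π) added) (cong (_+ progSize added) (progSize-redirect Π))))
    (ℕₚ.+-monoʳ-≤ (progSize Π) progSize-added)
    where
    added : Program
    added = (entryRules ++ edgeRules) ++ allExitRules

module _ {n : ℕ} (q : CQ n) (T : Ontology) where

  NDLRewArbitrary-viaCompletion : (Π Π′ : Program) (g : ℕ) → NDLRewComplete q T Π g → Nonrecursive Π′ →
    (∀ A (a : Tuple n) → Derives Π′ A g (VF.toList a) ⇔ Derives Π (Completion.completion T A) g (VF.toList a)) →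
    NDLRewArbitrary q T Π′ g
  NDLRewArbitrary-viaCompletion Π Π′ g (_ , rewΠ) nonrec Π′⇔Π = nonrec , λ A a a⊆A →
      (λ e → from (Π′⇔Π A a) (proj₁ (onCompletion A a a⊆A) (Completion.entailsQ-to-completion T A q a e)))
    , (λ d → Completion.entailsQ-from-completion T A q a (proj₂ (onCompletion A a a⊆A) (to (Π′⇔Π A a) d)))
    where
    onCompletion : ∀ A (a : Tuple n) → a ⊆ind A →
      let open Completion T A in
      (EntailsQ T completion q a → Derives Π completion g (VF.toList a)) × (Derives Π completion g (VF.toList a) → EntailsQ T completion q a)
    onCompletion A a a⊆A = rewΠ completion completion-Complete a (λ i → ind-completion⁺ (a⊆A i))
      where open Completion T A

  redirect-NDLRewArbitrary : (Π : Program) (g : ℕ) → (rew : NDLRewComplete q T Π g) →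
    NDLRewArbitrary q T (NDLConstruction.Π′ T Π g) g
  redirect-NDLRewArbitrary Π g rew = NDLRewArbitrary-viaCompletion Π Π′ g rew
    (NDLConstruction.Ranking.nonrecursive T Π g (proj₁ rew))
    (λ A a → mk⇔ (λ d → Semantics.reflect A d g<fresh) (Semantics.simulate A))
    where open NDLConstruction T Π g

lemma1 : (Σ ℕ λ c → {n : ℕ} (q : CQ n) (T : Ontology) (φ : Fm n) → FORewComplete q T φ →
    Σ (Fm n) λ ψ → FORewArbitrary q T ψ × fmSize ψ ≤ c * (fmSize φ * suc (ontSize T)))
    × (Σ ℕ λ c → {n : ℕ} (q : CQ n) (T : Ontology) (φ : Fm n) → IsPE φ → FORewComplete q T φ →
    Σ (Fm n) λ ψ → IsPE ψ × FORewArbitrary q T ψ × fmSize ψ ≤ c * (fmSize φ * suc (ontSize T)))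
    × (Σ ℕ λ c → {n : ℕ} (q : CQ n) (T : Ontology) (Π : Program) (g : ℕ) → NDLRewComplete q T Π g →
    Σ Program λ Π' → NDLRewArbitrary q T Π' g × progSize Π' ≤ progSize Π + c * ontSize T)
lemma1 = (200 , λ q T φ rew → expand T φ , expand-FORewArbitrary q T φ rew , fmSize-expand T φ)
       , (200 , λ q T φ φ-PE rew → expand T φ , substAtoms-PE (completedAtomFm T) (completedAtomFm-PE T) φ-PE
                                   , expand-FORewArbitrary q T φ rew , fmSize-expand T φ)
       , (100 , λ q T Π g rew → NDLConstruction.Π′ T Π g , redirect-NDLRewArbitrary q T Π g rew , NDLConstruction.progSize-Π′ T Π g)
  where open ExpandFO
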